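{- Let $q\equiv1\pmod4$ be a prime power and let $\rho_1,\rho_2,\rho_3,\rho_4\in\{ -1,1\}$. Then $|R_1(\rho_1,\rho_2,\rho_3,\rho_4)|=|R_1(\rho_2,\rho_1,\rho_4,\rho_3)|$ and $|T_2|=|T_2'|$; hence $|T|=|T_1|+2|T_2|$. Moreover $|R_i(\rho_1,\rho_2,\rho_3,\rho_4)|=|R_i(\rho_3,\rho_4,\rho_1,\rho_2)|$ for $i\in\{1,2\}$, and $R(\rho_1,\rho_2,-1,-1)=R(-1,-1,\rho_3,\rho_4)=\emptyset$.
   Context: Let $\mathbb{F}=\mathbb{F}_q$ and $\chi:\mathbb{F}\to\{ -1,0,1\}$ the quadratic character with $\chi(0)=0$. A square is an element $z^2$, $z\in\mathbb{F}$; a nonsquare is an element that is not a square. $\Sigma$ is the set of $(a,b)\in\mathbb{F}^2$ with $a\ne b$, $a,b\notin\{0,1\}$ and $ab$, $(1-a)(1-b)$ squares. $S$ is the set of $(x,y)\in\mathbb{F}^2$ with $x,y$ squares, $x\ne y$, $\{x,y\}\cap\{0,1\}=\emptyset$. $\Psi:\Sigma\to S$ is $\Psi(a,b)=(a/b,(1-a)/(1-b))$. For $(a,b)\in\Sigma$ let $\psi=\psi_{a,b}$, $\psi(u)=au$ if $u$ is a square and $\psi(u)=bu$ if $u$ is a nonsquare. Let $E(a,b)$ be the set of $(u,v)\in\mathbb{F}^2\setminus\{(0,0)\}$ with $\psi(\psi(u)-v)=\psi(-v)+\psi(u-v-\psi(-v))$. For $i,j,r,s\in\{0,1\}$, $E_{ij}^{rs}(a,b)$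 is the set of $(u,v)\in E(a,b)$ such that: $i=0$ iff $u$ is a square; $j=0$ iff $-v$ is a square; $r=0$ iff $\psi(u)-v$ is a square; $s=0$ iff $u-v-\psi(-v)$ is a square. $\Sigma_{ij}^{rs}=\{(a,b)\in\Sigma:E_{ij}^{rs}(a,b)\ne\emptyset\}$, $S_{ij}^{rs}=\Psi(\Sigma_{ij}^{rs})$, and $T=S\setminus\bigcup_{i,j,r,s\in\{0,1\}}S_{ij}^{rs}$. For $(x,y)$ write $\varepsilon=\chi(x-y)$. $T_1=\{(x,y)\in T:\chi(1-x)=\chi(1-y)=-\varepsilon\}$, $T_2=\{(x,y)\in T:\chi(1-x)=\varepsilon,\ \chi(1-y)=-\varepsilon\}$, $T_2'=\{(x,y)\in T:\chi(1-x)=-\varepsilon,\ \chi(1-y)=\varepsilon\}$. With $f_1=x^2+y^2-xy-x$, $f_2=y^2+x^2-xy-y$, $f_3=y^2x+xy-x^2-y^2$, $f_4=x^2y+xy-x^2-y^2$, define $R(\rho_1,\rho_2,\rho_3,\rho_4)=\{(x,y)\in T:\rho_j=\varepsilon\,\chi(f_j(x,y))\text{ for }1\le j\le4\}$ and $R_i(\rho_1,\dots,\rho_4)=T_i\cap R(\rho_1,\dots,\rho_4)$ for $i\in\{1,2\}$. -}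

module Defs where

open import Level using (0ℓ)
open import Data.Nat as ℕ using (ℕ)
open import Data.Nat.Primality using (Prime)
open import Data.Integer as ℤ using (ℤ; +_; -[1+_])
open import Data.Fin using (Fin; zero; suc)
open import Data.Product using (Σ; ∃; ∃-syntax; _×_; _,_; proj₁; proj₂)
open import Data.List using (List; length)
open import Data.List.Membership.Propositional using (_∈_)
open import Data.List.Relation.Unary.Unique.Propositional using (Unique)
open import Data.List.Relation.Unary.Any using (any?)
open import Algebra.Structures using (IsCommutativeRing)
open import Function.Bundles using (_⇔_)
open import Relation.Nullary using (¬_; Dec; yes; no)
open import Relation.Nullary.Decidable using (map′)
open import Relation.Binary.PropositionalEquality using (_≡_; _≢_; refl)
open import Relation.Binary.Definitions using (DecidableEquality)

HasSize : {A : Set} → (A → Set) → ℕ → Set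
HasSize {A} P n = Σ (List A) λ l → Unique l × (∀ a → (a ∈ l) ⇔ P a) × length l ≡ n

SameSize : {A : Set} → (A → Set) → (A → Set) → Set
SameSize P Q = ∃[ n ] (HasSize P n × HasSize Q n)

IsPrimePower : ℕ → Set
IsPrimePower q = ∃[ p ] ∃[ k ] (Prime p × k ℕ.≥ 1 × q ≡ p ℕ.^ k)

record FiniteField : Set₁ where
  infixl 7 _*_
  infixl 6 _+_ _-_
  field
    Carrier : Set
    _+_ _*_ : Carrier → Carrier → Carrier
    -_      : Carrier → Carrier
    0# 1#   : Carrier
    isCommutativeRing : IsCommutativeRing _≡_ _+_ _*_ -_ 0# 1#
    0≢1     : 0# ≢ 1#
    _⁻¹     : Carrier → Carrier
    inverseʳ : ∀ x → x ≢ 0# → x * (x ⁻¹) ≡ 1#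
    _≟_     : DecidableEquality Carrier
    elements : List Carrier
    elements-complete : ∀ x → x ∈ elements
    elements-unique   : Unique elements

  _-_ : Carrier → Carrier → Carrier
  x - y = x + (- y)

  order : ℕ
  order = length elements

module FFDefs (F : FiniteField) where
  open FiniteField F

  Point : Set
  Point = Carrier × Carrier

  -- z² for some z (0 is a square)
  IsSquare : Carrier → Set
  IsSquare x = ∃[ z ] (z * z ≡ x)

  NonSquare : Carrier → Set
  NonSquare x = ¬ IsSquare x

  square? : (x : Carrier) → Dec (IsSquare x)
  square? x = map′ to from (any? (λ z → (z * z) ≟ x) elements)
    where
    open import Data.List.Relation.Unary.Any using (Any; here; there; satisfied)
    to : Any (λ z → z * z ≡ x) elements → IsSquare x
    to a = satisfied a
    from : IsSquare x → Any (λ z → z * z ≡ x) elements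
    from (z , e) = Data.List.Relation.Unary.Any.map (λ { refl → e }) (elements-complete z)

  χ : Carrier → ℤ
  χ x with x ≟ 0#
  ... | yes _ = + 0
  ... | no _ with square? x
  ... | yes _ = + 1
  ... | no _ = -[1+ 0 ]

  InΣ : Point → Set
  InΣ (a , b) = a ≢ b × a ≢ 0# × a ≢ 1# × b ≢ 0# × b ≢ 1#
              × IsSquare (a * b) × IsSquare ((1# - a) * (1# - b))

  InS : Point → Set
  InS (x , y) = IsSquare x × IsSquare y × x ≢ y
              × x ≢ 0# × x ≢ 1# × y ≢ 0# × y ≢ 1#

  Ψ : Point → Point
  Ψ (a , b) = (a * (b ⁻¹) , (1# - a) * ((1# - b) ⁻¹))

  ψ : Point → Carrier → Carrier
  ψ (a , b) u with square? u
  ... | yes _ = a * u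
  ... | no _ = b * u

  InE : Point → Point → Set
  InE ab (u , v) = ((u , v) ≢ (0# , 0#))
                 × ψ ab (ψ ab u - v) ≡ ψ ab (- v) + ψ ab (u - v - ψ ab (- v))

  Cls : Fin 2 → Carrier → Set
  Cls zero x = IsSquare x
  Cls (suc _) x = NonSquare x

  InEᵢⱼʳˢ : Fin 2 → Fin 2 → Fin 2 → Fin 2 → Point → Point → Set
  InEᵢⱼʳˢ i j r s ab (u , v) =
    InE ab (u , v) × Cls i u × Cls j (- v)
    × Cls r (ψ ab u - v) × Cls s (u - v - ψ ab (- v))

  InΣᵢⱼʳˢ : Fin 2 → Fin 2 → Fin 2 → Fin 2 → Point → Set
  InΣᵢⱼʳˢ i j r s ab = InΣ ab × ∃[ uv ] InEᵢⱼʳˢ i j r s ab uv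

  InSᵢⱼʳˢ : Fin 2 → Fin 2 → Fin 2 → Fin 2 → Point → Set
  InSᵢⱼʳˢ i j r s xy = ∃[ ab ] (InΣᵢⱼʳˢ i j r s ab × Ψ ab ≡ xy)

  InT : Point → Set
  InT xy = InS xy × (∀ i j r s → ¬ InSᵢⱼʳˢ i j r s xy)

  ε : Point → ℤ
  ε (x , y) = χ (x - y)

  InT₁ : Point → Set
  InT₁ (x , y) = InT (x , y) × χ (1# - x) ≡ ℤ.- ε (x , y) × χ (1# - y) ≡ ℤ.- ε (x , y)

  InT₂ : Point → Set
  InT₂ (x , y) = InT (x , y) × χ (1# - x) ≡ ε (x , y) × χ (1# - y) ≡ ℤ.- ε (x , y)

  InT₂′ : Point → Set
  InT₂′ (x , y) = InT (x , y) × χ (1# - x) ≡ ℤ.- ε (x , y) × χ (1# - y) ≡ ε (x , y)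

  f₁ f₂ f₃ f₄ : Point → Carrier
  f₁ (x , y) = x * x + y * y - x * y - x
  f₂ (x , y) = y * y + x * x - x * y - y
  f₃ (x , y) = y * y * x + x * y - x * x - y * y
  f₄ (x , y) = x * x * y + x * y - x * x - y * y

  InR : ℤ → ℤ → ℤ → ℤ → Point → Set
  InR ρ₁ ρ₂ ρ₃ ρ₄ p =
    InT p × ρ₁ ≡ ε p ℤ.* χ (f₁ p) × ρ₂ ≡ ε p ℤ.* χ (f₂ p)
          × ρ₃ ≡ ε p ℤ.* χ (f₃ p) × ρ₄ ≡ ε p ℤ.* χ (f₄ p)

  InR₁ : ℤ → ℤ → ℤ → ℤ → Point → Set
  InR₁ ρ₁ ρ₂ ρ₃ ρ₄ p = InT₁ p × InR ρ₁ ρ₂ ρ₃ ρ₄ p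

  InR₂ : ℤ → ℤ → ℤ → ℤ → Point → Set
  InR₂ ρ₁ ρ₂ ρ₃ ρ₄ p = InT₂ p × InR ρ₁ ρ₂ ρ₃ ρ₄ p

IsSign : ℤ → Set
IsSign ρ = ρ ≡ + 1 Data.Sum.⊎ ρ ≡ -[1+ 0 ]
  where import Data.Sum

-- For (x , y) ∈ S put b = (1 - y) / (x - y) and a = x b; then (a , b) ∈ Σ and Ψ (a , b) = (x , y).
-- Moreover (1 , 1) ∈ E(a , b) if χ(1 - x) = χ(1 - y) = ε, and (x , y) ∈ E(a , b) if
-- ε χ(f₃) = ε χ(f₄) = -1; neither happens on T, whence T = T₁ ⊔ T₂ ⊔ T₂′ and R(ρ₁ , ρ₂ , -1 , -1) = ∅.
-- Two involutions preserve T: the swap (x , y) ↦ (y , x), lifted by (a , b) ↦ (1 - a , 1 - b) and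
-- (u , v) ↦ (- v , - u), and the inversion (x , y) ↦ (x⁻¹ , y⁻¹), lifted by (a , b) ↦ (b , a) and
-- (u , v) ↦ (g u , g v) for a nonsquare g. As -1 is a square (q ≡ 1 mod 4), both fix ε; the swap
-- exchanges χ(f₁) ↔ χ(f₂), χ(f₃) ↔ χ(f₄) and T₂ ↔ T₂′, while the inversion fixes χ(1 - x), χ(1 - y)
-- and exchanges χ(f₁) ↔ χ(f₃), χ(f₂) ↔ χ(f₄). The cardinality statements follow, and the inversion
-- maps R(-1 , -1 , ρ₃ , ρ₄) into R(ρ₃ , ρ₄ , -1 , -1) = ∅.

module Submission where

open import Defs

open import Algebra.Bundles using (CommutativeRing)
import Algebra.Properties.CommutativeSemigroup as CommutativeSemigroupProperties
import Algebra.Properties.Ring as RingProperties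
import Algebra.Properties.Semiring.Mult.TCOptimised as SemiringMultiplication
import Algebra.Solver.Ring as RingSolver
open import Algebra.Solver.Ring.AlmostCommutativeRing
  using (fromCommutativeRing; _-Raw-AlmostCommutative⟶_)
open import Algebra.Structures using (IsCommutativeRing)
open import Data.Empty using (⊥; ⊥-elim)
open import Data.Fin using (Fin; zero; suc)
open import Data.Integer as ℤ using (ℤ; -[1+_]; _⊖_; 0ℤ; 1ℤ; -1ℤ)
import Data.Integer.Properties as ℤ
open import Data.List using (List; []; _∷_; length; map; filter; _++_; lookup; cartesianProduct)
open import Data.List.Membership.Propositional using (_∈_)
open import Data.List.Membership.Propositional.Properties using (∈-map⁺; ∈-map⁻; ∈-filter⁺; ∈-filter⁻; ∈-++⁺ˡ; ∈-++⁺ʳ; ∈-++⁻; ∈-cartesianProduct⁺)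
open import Data.List.Properties using (length-map; length-++; length-filter)
open import Data.List.Relation.Unary.Any as Any using (Any; here; there; any?; satisfied)
open import Data.List.Relation.Unary.Unique.Propositional using (Unique)
import Data.List.Relation.Unary.Unique.Propositional.Properties as Unique
open import Data.Maybe using (Maybe; just; nothing)
open import Data.Nat as ℕ using (ℕ; zero; suc; _%_)
import Data.Nat.Properties as ℕ
open import Data.Product using (Σ; ∃-syntax; _×_; _,_; proj₁; proj₂; swap)
open import Data.Product.Properties using (≡-dec)
import Data.Sign as Sign
open import Data.Sum using (_⊎_; inj₁; inj₂; [_,_]′)
open import Data.Unit using (⊤; tt)
open import Function using (_∘_; id)
open import Function.Bundles using (_⇔_; mk⇔; Equivalence)
open import Level using (Level)
open import Relation.Binary.PropositionalEquality
open import Relation.Nullary using (¬_; ¬?; Dec; yes; no; contradiction)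
open import Relation.Nullary.Decidable using (_×-dec_; map′)
open import Relation.Unary using (Decidable)

-- The ring solver of the library needs a coefficient ring that computes; for an
-- abstract commutative ring we use ℤ through its canonical homomorphism.
module IntegerCoefficientSolver {a : Level} {A : Set a} {add mul : A → A → A} {neg : A → A} {0ᴬ 1ᴬ : A}
  (isCommutativeRing : IsCommutativeRing _≡_ add mul neg 0ᴬ 1ᴬ) where

  R : CommutativeRing a a
  R = record { isCommutativeRing = isCommutativeRing }

  open CommutativeRing R using (_+_; _*_; -_; 0#; 1#; +-comm; +-identityˡ; +-identityʳ; -‿inverseʳ; ring; +-commutativeSemigroup)
  open RingProperties ring using (-0#≈0#; -‿+-comm; -‿distribˡ-*; -‿distribʳ-*; -‿involutive)
  open CommutativeSemigroupProperties +-commutativeSemigroup using (interchange)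
  open SemiringMultiplication (CommutativeRing.semiring R) using (×-homo-+; ×1-homo-*; 1+×) renaming (_×_ to _×ₙ_)
  open ≡-Reasoning

  fromℤ : ℤ → A
  fromℤ (ℤ.+ n)    = n ×ₙ 1#
  fromℤ -[1+ n ] = - (suc n ×ₙ 1#)

  fromℤ-neg : ∀ i → fromℤ (ℤ.- i) ≡ - fromℤ i
  fromℤ-neg (ℤ.+ zero)    = sym -0#≈0#
  fromℤ-neg (ℤ.+ suc n)   = refl
  fromℤ-neg -[1+ n ]    = sym (-‿involutive _)

  private
    1+x-[1+y]≡x-y : ∀ x y → (1# + x) + - (1# + y) ≡ x + - y
    1+x-[1+y]≡x-y x y = begin
      (1# + x) + - (1# + y)   ≡⟨ cong ((1# + x) +_) (sym (-‿+-comm 1# y)) ⟩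
      (1# + x) + (- 1# + - y) ≡⟨ interchange 1# x (- 1#) (- y) ⟩
      (1# + - 1#) + (x + - y) ≡⟨ cong (_+ (x + - y)) (-‿inverseʳ 1#) ⟩
      0# + (x + - y)          ≡⟨ +-identityˡ _ ⟩
      x + - y                 ∎

  fromℤ-⊖ : ∀ m n → fromℤ (m ⊖ n) ≡ m ×ₙ 1# + - (n ×ₙ 1#)
  fromℤ-⊖ zero    zero    = sym (trans (cong (0# +_) -0#≈0#) (+-identityʳ 0#))
  fromℤ-⊖ zero    (suc n) = sym (+-identityˡ _)
  fromℤ-⊖ (suc m) zero    = sym (trans (cong (suc m ×ₙ 1# +_) -0#≈0#) (+-identityʳ _))
  fromℤ-⊖ (suc m) (suc n) = begin
    fromℤ (suc m ⊖ suc n)                  ≡⟨ cong fromℤ (ℤ.[1+m]⊖[1+n]≡m⊖n m n) ⟩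
    fromℤ (m ⊖ n)                          ≡⟨ fromℤ-⊖ m n ⟩
    m ×ₙ 1# + - (n ×ₙ 1#)                    ≡⟨ sym (1+x-[1+y]≡x-y _ _) ⟩
    (1# + m ×ₙ 1#) + - (1# + n ×ₙ 1#)        ≡⟨ sym (cong₂ (λ p q → p + - q) (1+× m 1#) (1+× n 1#)) ⟩
    suc m ×ₙ 1# + - (suc n ×ₙ 1#)            ∎

  fromℤ-+ : ∀ i j → fromℤ (i ℤ.+ j) ≡ fromℤ i + fromℤ j
  fromℤ-+ (ℤ.+ m)    (ℤ.+ n)    = ×-homo-+ 1# m n
  fromℤ-+ (ℤ.+ m)    -[1+ n ] = fromℤ-⊖ m (suc n)
  fromℤ-+ -[1+ m ] (ℤ.+ n)    = trans (fromℤ-⊖ n (suc m)) (+-comm _ _)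
  fromℤ-+ -[1+ m ] -[1+ n ] = begin
    - (suc (suc (m ℕ.+ n)) ×ₙ 1#)           ≡⟨ cong (λ k → - (suc k ×ₙ 1#)) (sym (ℕ.+-suc m n)) ⟩
    - ((suc m ℕ.+ suc n) ×ₙ 1#)             ≡⟨ cong -_ (×-homo-+ 1# (suc m) (suc n)) ⟩
    - (suc m ×ₙ 1# + suc n ×ₙ 1#)            ≡⟨ sym (-‿+-comm _ _) ⟩
    - (suc m ×ₙ 1#) + - (suc n ×ₙ 1#)        ∎

  fromℤ-* : ∀ i j → fromℤ (i ℤ.* j) ≡ fromℤ i * fromℤ j
  fromℤ-* (ℤ.+ m) (ℤ.+ n) = begin
    fromℤ (Sign.+ ℤ.◃ m ℕ.* n)             ≡⟨ cong fromℤ (ℤ.+◃n≡+n (m ℕ.* n)) ⟩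
    (m ℕ.* n) ×ₙ 1#                         ≡⟨ ×1-homo-* m n ⟩
    (m ×ₙ 1#) * (n ×ₙ 1#)                    ∎
  fromℤ-* (ℤ.+ m) -[1+ n ] = begin
    fromℤ (Sign.- ℤ.◃ m ℕ.* suc n)         ≡⟨ cong fromℤ (ℤ.-◃n≡-n (m ℕ.* suc n)) ⟩
    fromℤ (ℤ.- ℤ.+ (m ℕ.* suc n))            ≡⟨ fromℤ-neg (ℤ.+ (m ℕ.* suc n)) ⟩
    - ((m ℕ.* suc n) ×ₙ 1#)                 ≡⟨ cong -_ (×1-homo-* m (suc n)) ⟩
    - ((m ×ₙ 1#) * (suc n ×ₙ 1#))            ≡⟨ -‿distribʳ-* _ _ ⟩
    (m ×ₙ 1#) * - (suc n ×ₙ 1#)              ∎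
  fromℤ-* -[1+ m ] (ℤ.+ n) = begin
    fromℤ (Sign.- ℤ.◃ suc m ℕ.* n)         ≡⟨ cong fromℤ (ℤ.-◃n≡-n (suc m ℕ.* n)) ⟩
    fromℤ (ℤ.- ℤ.+ (suc m ℕ.* n))            ≡⟨ fromℤ-neg (ℤ.+ (suc m ℕ.* n)) ⟩
    - ((suc m ℕ.* n) ×ₙ 1#)                 ≡⟨ cong -_ (×1-homo-* (suc m) n) ⟩
    - ((suc m ×ₙ 1#) * (n ×ₙ 1#))            ≡⟨ -‿distribˡ-* _ _ ⟩
    - (suc m ×ₙ 1#) * (n ×ₙ 1#)              ∎
  fromℤ-* -[1+ m ] -[1+ n ] = begin
    (suc m ℕ.* suc n) ×ₙ 1#                 ≡⟨ ×1-homo-* (suc m) (suc n) ⟩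
    (suc m ×ₙ 1#) * (suc n ×ₙ 1#)            ≡⟨ sym (-‿involutive _) ⟩
    - - ((suc m ×ₙ 1#) * (suc n ×ₙ 1#))      ≡⟨ cong -_ (-‿distribˡ-* _ _) ⟩
    - (- (suc m ×ₙ 1#) * (suc n ×ₙ 1#))      ≡⟨ -‿distribʳ-* _ _ ⟩
    - (suc m ×ₙ 1#) * - (suc n ×ₙ 1#)        ∎

  fromℤ-homomorphism : CommutativeRing.rawRing ℤ.+-*-commutativeRing -Raw-AlmostCommutative⟶ fromCommutativeRing R
  fromℤ-homomorphism = record
    { ⟦_⟧ = fromℤ ; +-homo = fromℤ-+ ; *-homo = fromℤ-* ; -‿homo = fromℤ-neg ; 0-homo = refl ; 1-homo = refl }

  fromℤ-≟ : ∀ i j → Maybe (fromℤ i ≡ fromℤ j)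
  fromℤ-≟ i j with i ℤ.≟ j
  ... | yes refl = just refl
  ... | no _     = nothing

  open RingSolver (CommutativeRing.rawRing ℤ.+-*-commutativeRing) (fromCommutativeRing R) fromℤ-homomorphism fromℤ-≟ public

module Cardinality where

  open import Data.List.Membership.Propositional.Properties.WithK using (unique∧set⇒bag)
  open import Data.List.Relation.Binary.BagAndSetEquality using (∼bag⇒↭)
  open import Data.List.Relation.Binary.Permutation.Propositional.Properties using (↭-length)
  open import Data.List.Relation.Unary.All as All using (All; []; _∷_)
  open import Data.List.Relation.Unary.AllPairs using ([]; _∷_)
  open import Data.List.Relation.Unary.Any using (index)
  open import Data.List.Relation.Unary.Any.Properties using (lookup-index)
  open import Data.Fin using (toℕ)
  open import Data.Fin.Properties using (toℕ-injective)
  open import Relation.Binary.Definitions using (DecidableEquality)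

  private
    members : {A : Set} {P : A → Set} {l : List A} → (∀ a → (a ∈ l) ⇔ P a) → ∀ {a} → a ∈ l → P a
    members l⇔P = Equivalence.to (l⇔P _)

    listed : {A : Set} {P : A → Set} {l : List A} → (∀ a → (a ∈ l) ⇔ P a) → ∀ {a} → P a → a ∈ l
    listed l⇔P = Equivalence.from (l⇔P _)

  length-unique : {A : Set} {xs ys : List A} → Unique xs → Unique ys → (∀ {x} → x ∈ xs ⇔ x ∈ ys) → length xs ≡ length ys
  length-unique xs! ys! xs⇔ys = ↭-length (∼bag⇒↭ (unique∧set⇒bag xs! ys! xs⇔ys))

  HasSize-unique : {A : Set} {P : A → Set} {m n : ℕ} → HasSize P m → HasSize P n → m ≡ n
  HasSize-unique (l , l! , l⇔P , refl) (l′ , l′! , l′⇔P , refl) =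
    length-unique l! l′! (mk⇔ (λ x∈l → listed l′⇔P (members l⇔P x∈l)) (λ x∈l′ → listed l⇔P (members l′⇔P x∈l′)))

  private
    map-unique : {A : Set} (f : A → A) (l : List A) → (∀ {x y} → x ∈ l → y ∈ l → f x ≡ f y → x ≡ y) → Unique l → Unique (map f l)
    map-unique f []       _   []         = []
    map-unique {A} f (x ∷ xs) inj (x∉ ∷ xs!) = fx∉ xs x∉ (λ y∈ → y∈) ∷ map-unique f xs (λ x∈ y∈ → inj (there x∈) (there y∈)) xs!
      where
      fx∉ : (ys : List A) → All (x ≢_) ys → (∀ {y} → y ∈ ys → y ∈ xs) → All (f x ≢_) (map f ys)
      fx∉ []       []         _   = []
      fx∉ (y ∷ ys) (x≢y ∷ ne) sub = (λ e → x≢y (inj (here refl) (there (sub (here refl))) e)) ∷ fx∉ ys ne (sub ∘ there)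

  HasSize-bijection : {A : Set} {P Q : A → Set} {n : ℕ} (f g : A → A) → (∀ a → P a → Q (f a)) → (∀ a → Q a → P (g a)) →
    (∀ a → P a → g (f a) ≡ a) → (∀ a → Q a → f (g a) ≡ a) → HasSize P n → HasSize Q n
  HasSize-bijection {P = P} {Q = Q} f g P→Q Q→P gf fg (l , l! , l⇔P , l-length) =
    map f l , map-unique f l f-injective l! , (λ a → mk⇔ (to a) (from a)) , trans (length-map f l) l-length
    where
    f-injective : ∀ {x y} → x ∈ l → y ∈ l → f x ≡ f y → x ≡ y
    f-injective {x} {y} x∈ y∈ e = trans (sym (gf x (members l⇔P x∈))) (trans (cong g e) (gf y (members l⇔P y∈)))
    to : ∀ a → a ∈ map f l → Q a
    to a a∈ with ∈-map⁻ f a∈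
    ... | b , b∈ , refl = P→Q b (members l⇔P b∈)
    from : ∀ a → Q a → a ∈ map f l
    from a q = subst (_∈ map f l) (fg a q) (∈-map⁺ f (listed l⇔P (Q→P a q)))

  HasSize-⊎ : {A : Set} {P Q₁ Q₂ : A → Set} {m n : ℕ} → HasSize Q₁ m → HasSize Q₂ n → (∀ a → Q₁ a → Q₂ a → ⊥) →
    (∀ a → P a → Q₁ a ⊎ Q₂ a) → (∀ a → Q₁ a → P a) → (∀ a → Q₂ a → P a) → HasSize P (m ℕ.+ n)
  HasSize-⊎ {P = P} (l₁ , l₁! , l₁⇔ , refl) (l₂ , l₂! , l₂⇔ , refl) disjoint cover Q₁→P Q₂→P =
    l₁ ++ l₂ , Unique.++⁺ l₁! l₂! (λ (a∈₁ , a∈₂) → disjoint _ (members l₁⇔ a∈₁) (members l₂⇔ a∈₂)) ,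
    (λ a → mk⇔ (to a) (from a)) , length-++ l₁
    where
    to : ∀ a → a ∈ l₁ ++ l₂ → P a
    to a a∈ with ∈-++⁻ l₁ a∈
    ... | inj₁ a∈₁ = Q₁→P a (members l₁⇔ a∈₁)
    ... | inj₂ a∈₂ = Q₂→P a (members l₂⇔ a∈₂)
    from : ∀ a → P a → a ∈ l₁ ++ l₂
    from a p with cover a p
    ... | inj₁ q₁ = ∈-++⁺ˡ (listed l₁⇔ q₁)
    ... | inj₂ q₂ = ∈-++⁺ʳ l₁ (listed l₂⇔ q₂)

  HasSize-≡ : {A : Set} (c : A) → HasSize (_≡ c) 1
  HasSize-≡ c = c ∷ [] , [] ∷ [] , (λ a → mk⇔ (λ { (here e) → e ; (there ()) }) here) , refl

  module Enumeration {A : Set} (_≟_ : DecidableEquality A) (elements : List A)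
    (elements-unique : Unique elements) (elements-complete : ∀ x → x ∈ elements) where

    open import Data.List.Membership.DecPropositional _≟_ using (_∈?_)

    HasSize-filter : {P : A → Set} (P? : Decidable P) → HasSize P (length (filter P? elements))
    HasSize-filter P? = filter P? elements , Unique.filter⁺ P? {elements} elements-unique ,
      (λ a → mk⇔ (λ a∈ → proj₂ (∈-filter⁻ P? {xs = elements} a∈)) (∈-filter⁺ P? (elements-complete a))) , refl

    SameSize-involution : {P Q : A → Set} (σ : A → A) → Decidable P →
      (∀ a → P a → Q (σ a)) → (∀ a → Q a → P (σ a)) → (∀ a → P a → σ (σ a) ≡ a) → (∀ a → Q a → σ (σ a) ≡ a) →
      SameSize P Q
    SameSize-involution σ P? P→Q Q→P σσ≡id-P σσ≡id-Q =
      _ , HasSize-filter P? , HasSize-bijection σ σ P→Q Q→P σσ≡id-P σσ≡id-Q (HasSize-filter P?)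

    private
      length-⊆ : {P : A → Set} {n : ℕ} {ys : List A} → Unique ys → (∀ y → y ∈ ys → P y) → HasSize P n → length ys ℕ.≤ n
      length-⊆ {ys = ys} ys! ys⊆P (l , l! , l⇔P , refl) =
        subst (ℕ._≤ length l) (sym (length-unique ys! (Unique.filter⁺ (_∈? ys) {l} l!) ys⇔))
          (length-filter (_∈? ys) l)
        where
        ys⇔ : ∀ {x} → x ∈ ys ⇔ x ∈ filter (_∈? ys) l
        ys⇔ = mk⇔ (λ x∈ → ∈-filter⁺ (_∈? ys) (listed l⇔P (ys⊆P _ x∈)) x∈) (λ x∈ → proj₂ (∈-filter⁻ (_∈? ys) {xs = l} x∈))

    pigeonhole : {P : A → Set} {n : ℕ} {xs : List A} → Unique xs → (∀ y → y ∈ xs → P y) → HasSize P n → n ℕ.≤ length xs →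
      ∀ a → P a → a ∈ xs
    pigeonhole {P} {xs = xs} xs! xs⊆P P-size n≤ a pa with a ∈? xs
    ... | yes a∈ = a∈
    ... | no a∉ = ⊥-elim (ℕ.<-irrefl refl (ℕ.≤-trans (length-⊆ a∷xs! ⊆P P-size) n≤))
      where
      ⊆P : ∀ y → y ∈ a ∷ xs → P y
      ⊆P y (here refl) = pa
      ⊆P y (there y∈) = xs⊆P y y∈
      a∷xs! : Unique (a ∷ xs)
      a∷xs! = All.tabulate (λ y∈ a≡y → a∉ (subst (_∈ xs) (sym a≡y) y∈)) ∷ xs!

    position : A → ℕ
    position x = toℕ (index (elements-complete x))

    position-injective : ∀ {x y} → position x ≡ position y → x ≡ y
    position-injective {x} {y} e =
      trans (lookup-index (elements-complete x)) (trans (cong (lookup elements) (toℕ-injective e)) (sym (lookup-index (elements-complete y))))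

    module Orbits {D : A → Set} (σ : A → A) (σ-closed : ∀ a → D a → D (σ a))
      (σ-involutive : ∀ a → D a → σ (σ a) ≡ a) (σ-fixed-point-free : ∀ a → D a → σ a ≢ a) where

      Representative : A → Set
      Representative a = D a × position a ℕ.< position (σ a)

      Representative? : Decidable D → Decidable Representative
      Representative? D? a = D? a ×-dec (position a ℕ.<? position (σ a))

      private
        NonRepresentative : A → Set
        NonRepresentative a = D a × ¬ position a ℕ.< position (σ a)

        position-σ-< : ∀ a → D a → ¬ position a ℕ.< position (σ a) → position (σ a) ℕ.< position (σ (σ a))
        position-σ-< a d ≮ = subst (λ z → position (σ a) ℕ.< position z) (sym (σ-involutive a d))
          (ℕ.≤∧≢⇒< (ℕ.≮⇒≥ ≮) (λ e → σ-fixed-point-free a d (position-injective e)))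

        σ-not-Representative : ∀ a → Representative a → ¬ position (σ a) ℕ.< position (σ (σ a))
        σ-not-Representative a (d , <σ) σ< = ℕ.<-asym <σ (subst (λ z → position (σ a) ℕ.< position z) (σ-involutive a d) σ<)

      HasSize-orbits : ∀ {k} → HasSize Representative k → HasSize D (k ℕ.+ k)
      HasSize-orbits reps = HasSize-⊎ reps nonreps (λ a r r′ → proj₂ r′ (proj₂ r)) cover (λ _ → proj₁) (λ _ → proj₁)
        where
        σ-rep : ∀ a → Representative a → NonRepresentative (σ a)
        σ-rep a r = σ-closed a (proj₁ r) , σ-not-Representative a r
        σ-nonrep : ∀ a → NonRepresentative a → Representative (σ a)
        σ-nonrep a (d , ≮) = σ-closed a d , position-σ-< a d ≮
        nonreps = HasSize-bijection σ σ σ-rep σ-nonrep (λ a r → σ-involutive a (proj₁ r)) (λ a r → σ-involutive a (proj₁ r)) reps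
        cover : ∀ a → D a → Representative a ⊎ NonRepresentative a
        cover a d with position a ℕ.<? position (σ a)
        ... | yes < = inj₁ (d , <)
        ... | no ≮ = inj₂ (d , ≮)

      representative : A → A
      representative a with position a ℕ.<? position (σ a)
      ... | yes _ = a
      ... | no _ = σ a

      representative-∈-orbit : ∀ a → representative a ≡ a ⊎ representative a ≡ σ a
      representative-∈-orbit a with position a ℕ.<? position (σ a)
      ... | yes _ = inj₁ refl
      ... | no _ = inj₂ refl

      representative-Representative : ∀ a → D a → Representative (representative a)
      representative-Representative a d with position a ℕ.<? position (σ a)
      ... | yes < = d , <
      ... | no ≮ = σ-closed a d , position-σ-< a d ≮

      representative-self : ∀ a → Representative a → representative a ≡ a
      representative-self a (_ , <) with position a ℕ.<? position (σ a)
      ... | yes _ = refl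
      ... | no ≮ = ⊥-elim (≮ <)

      representative-σ : ∀ a → Representative a → representative (σ a) ≡ a
      representative-σ a r with position (σ a) ℕ.<? position (σ (σ a))
      ... | yes σ< = ⊥-elim (σ-not-Representative a r σ<)
      ... | no _ = σ-involutive a (proj₁ r)

module FieldProperties (F : FiniteField) where

  open FiniteField F public
  open FFDefs F public
  open IntegerCoefficientSolver isCommutativeRing public using (R; solve; _:+_; _:-_; _:*_; :-_; con; _:=_)
  open CommutativeRing R public
    using (+-assoc; +-comm; +-identityˡ; +-identityʳ; *-identityˡ; *-identityʳ; *-assoc; *-comm;
           distribˡ; -‿inverseʳ; zeroˡ; zeroʳ)
  open RingProperties (CommutativeRing.ring R) public
    using (-‿involutive; -0#≈0#; -‿distribˡ-*; -‿distribʳ-*; -1*x≈-x)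
  open ≡-Reasoning

  x≡y+c*[k-1]⇒k≡1⇒x≡y : ∀ {x y c k} → x ≡ y + c * (k - 1#) → k ≡ 1# → x ≡ y
  x≡y+c*[k-1]⇒k≡1⇒x≡y {x} {y} {c} x≡ refl = begin
    x                    ≡⟨ x≡ ⟩
    y + c * (1# - 1#)    ≡⟨ cong (λ t → y + c * t) (-‿inverseʳ 1#) ⟩
    y + c * 0#           ≡⟨ cong (y +_) (zeroʳ c) ⟩
    y + 0#               ≡⟨ +-identityʳ y ⟩
    y                    ∎

  1≢0 : 1# ≢ 0#
  1≢0 = 0≢1 ∘ sym

  inverseˡ : ∀ x → x ≢ 0# → x ⁻¹ * x ≡ 1#
  inverseˡ x x≢0 = trans (*-comm _ _) (inverseʳ x x≢0)

  *-cancelˡ : ∀ {x a b} → x ≢ 0# → x * a ≡ x * b → a ≡ b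
  *-cancelˡ {x} {a} {b} x≢0 e = begin
    a                ≡⟨ sym (*-identityˡ a) ⟩
    1# * a           ≡⟨ cong (_* a) (sym (inverseˡ x x≢0)) ⟩
    (x ⁻¹ * x) * a   ≡⟨ *-assoc _ _ _ ⟩
    x ⁻¹ * (x * a)   ≡⟨ cong (x ⁻¹ *_) e ⟩
    x ⁻¹ * (x * b)   ≡⟨ sym (*-assoc _ _ _) ⟩
    (x ⁻¹ * x) * b   ≡⟨ cong (_* b) (inverseˡ x x≢0) ⟩
    1# * b           ≡⟨ *-identityˡ b ⟩
    b                ∎

  x*y≡0⇒x≡0⊎y≡0 : ∀ x y → x * y ≡ 0# → x ≡ 0# ⊎ y ≡ 0#
  x*y≡0⇒x≡0⊎y≡0 x y e with x ≟ 0#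
  ... | yes x≡0 = inj₁ x≡0
  ... | no x≢0  = inj₂ (*-cancelˡ x≢0 (trans e (sym (zeroʳ x))))

  x*y≢0 : ∀ {x y} → x ≢ 0# → y ≢ 0# → x * y ≢ 0#
  x*y≢0 {x} {y} x≢0 y≢0 e = [ x≢0 , y≢0 ]′ (x*y≡0⇒x≡0⊎y≡0 x y e)

  x⁻¹≢0 : ∀ {x} → x ≢ 0# → x ⁻¹ ≢ 0#
  x⁻¹≢0 {x} x≢0 e = 1≢0 (trans (sym (inverseʳ x x≢0)) (trans (cong (x *_) e) (zeroʳ x)))

  x*y≡1⇒y≡x⁻¹ : ∀ {x y} → x * y ≡ 1# → y ≡ x ⁻¹
  x*y≡1⇒y≡x⁻¹ {x} {y} e = *-cancelˡ x≢0 (trans e (sym (inverseʳ x x≢0)))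
    where
    x≢0 : x ≢ 0#
    x≢0 x≡0 = 1≢0 (trans (sym e) (trans (cong (_* y) x≡0) (zeroˡ y)))

  ⁻¹-involutive : ∀ {x} → x ≢ 0# → (x ⁻¹) ⁻¹ ≡ x
  ⁻¹-involutive {x} x≢0 = sym (x*y≡1⇒y≡x⁻¹ (inverseˡ x x≢0))

  1⁻¹≡1 : 1# ⁻¹ ≡ 1#
  1⁻¹≡1 = sym (x*y≡1⇒y≡x⁻¹ (*-identityˡ 1#))

  ⁻¹-distrib-* : ∀ {x y} → x ≢ 0# → y ≢ 0# → (x * y) ⁻¹ ≡ x ⁻¹ * y ⁻¹
  ⁻¹-distrib-* {x} {y} x≢0 y≢0 = sym (x*y≡1⇒y≡x⁻¹ (begin
    (x * y) * (x ⁻¹ * y ⁻¹)     ≡⟨ solve 4 (λ x y x′ y′ → (x :* y) :* (x′ :* y′) := (x :* x′) :* (y :* y′)) refl x y (x ⁻¹) (y ⁻¹) ⟩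
    (x * x ⁻¹) * (y * y ⁻¹)     ≡⟨ cong₂ _*_ (inverseʳ x x≢0) (inverseʳ y y≢0) ⟩
    1# * 1#                     ≡⟨ *-identityˡ 1# ⟩
    1#                          ∎))

  x*y*y⁻¹≡x : ∀ {x y} → y ≢ 0# → (x * y) * y ⁻¹ ≡ x
  x*y*y⁻¹≡x {x} {y} y≢0 = trans (*-assoc _ _ _) (trans (cong (x *_) (inverseʳ y y≢0)) (*-identityʳ x))

  x≢y⇒x-y≢0 : ∀ {x y} → x ≢ y → x - y ≢ 0#
  x≢y⇒x-y≢0 {x} {y} x≢y e = x≢y (begin
    x             ≡⟨ solve 2 (λ x y → x := (x :- y) :+ y) refl x y ⟩
    (x - y) + y   ≡⟨ cong (_+ y) e ⟩
    0# + y        ≡⟨ +-identityˡ y ⟩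
    y             ∎)

  -x≢0 : ∀ {x} → x ≢ 0# → - x ≢ 0#
  -x≢0 {x} x≢0 e = x≢0 (trans (sym (-‿involutive x)) (trans (cong -_ e) -0#≈0#))

  -x*-y≡x*y : ∀ x y → - x * - y ≡ x * y
  -x*-y≡x*y x y = solve 2 (λ x y → :- x :* :- y := x :* y) refl x y

  x*x≡y*y⇒x≡y⊎x≡-y : ∀ {x y} → x * x ≡ y * y → x ≡ y ⊎ x ≡ - y
  x*x≡y*y⇒x≡y⊎x≡-y {x} {y} e with x*y≡0⇒x≡0⊎y≡0 (x - y) (x + y) (begin
    (x - y) * (x + y)   ≡⟨ solve 2 (λ x y → (x :- y) :* (x :+ y) := x :* x :- y :* y) refl x y ⟩
    x * x - y * y       ≡⟨ cong (_- y * y) e ⟩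
    y * y - y * y       ≡⟨ -‿inverseʳ _ ⟩
    0#                  ∎)
  ... | inj₁ x-y≡0 = inj₁ (trans (solve 2 (λ x y → x := (x :- y) :+ y) refl x y) (trans (cong (_+ y) x-y≡0) (+-identityˡ y)))
  ... | inj₂ x+y≡0 = inj₂ (trans (solve 2 (λ x y → x := (x :+ y) :- y) refl x y) (trans (cong (_- y) x+y≡0) (+-identityˡ (- y))))

  square-0 : IsSquare 0#
  square-0 = 0# , zeroˡ 0#

  square-1 : IsSquare 1#
  square-1 = 1# , *-identityˡ 1#

  square-* : ∀ {x y} → IsSquare x → IsSquare y → IsSquare (x * y)
  square-* (z , refl) (w , refl) = z * w , solve 2 (λ z w → (z :* w) :* (z :* w) := (z :* z) :* (w :* w)) refl z w

  square-root≢0 : ∀ {z x} → z * z ≡ x → x ≢ 0# → z ≢ 0#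
  square-root≢0 {z} e x≢0 z≡0 = x≢0 (trans (sym e) (trans (cong (_* z) z≡0) (zeroˡ z)))

  square-⁻¹ : ∀ {x} → IsSquare x → x ≢ 0# → IsSquare (x ⁻¹)
  square-⁻¹ (z , e) x≢0 = z ⁻¹ , trans (sym (⁻¹-distrib-* z≢0 z≢0)) (cong _⁻¹ e)
    where z≢0 = square-root≢0 e x≢0

  square-cancelˡ : ∀ {s t} → IsSquare s → s ≢ 0# → IsSquare (s * t) → IsSquare t
  square-cancelˡ {s} {t} s-sq s≢0 st-sq = subst IsSquare s⁻¹st≡t (square-* (square-⁻¹ s-sq s≢0) st-sq)
    where
    s⁻¹st≡t : s ⁻¹ * (s * t) ≡ t
    s⁻¹st≡t = begin
      s ⁻¹ * (s * t)       ≡⟨ sym (*-assoc _ _ _) ⟩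
      (s ⁻¹ * s) * t       ≡⟨ cong (_* t) (inverseˡ s s≢0) ⟩
      1# * t               ≡⟨ *-identityˡ t ⟩
      t                    ∎

  nonsquare-*ˡ : ∀ {s n} → IsSquare s → s ≢ 0# → NonSquare n → NonSquare (s * n)
  nonsquare-*ˡ s-sq s≢0 n-ns sn-sq = n-ns (square-cancelˡ s-sq s≢0 sn-sq)

  nonsquare-*ʳ : ∀ {s n} → IsSquare s → s ≢ 0# → NonSquare n → NonSquare (n * s)
  nonsquare-*ʳ {s} {n} s-sq s≢0 n-ns = nonsquare-*ˡ s-sq s≢0 n-ns ∘ subst IsSquare (*-comm n s)

  nonsquare⇒≢0 : ∀ {n} → NonSquare n → n ≢ 0#
  nonsquare⇒≢0 n-ns refl = n-ns square-0

  ψ-square : ∀ {a b z} → IsSquare z → ψ (a , b) z ≡ a * z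
  ψ-square {z = z} z-sq with square? z
  ... | yes _ = refl
  ... | no z-ns = contradiction z-sq z-ns

  ψ-nonsquare : ∀ {a b z} → NonSquare z → ψ (a , b) z ≡ b * z
  ψ-nonsquare {z = z} z-ns with square? z
  ... | yes z-sq = contradiction z-sq z-ns
  ... | no _ = refl

  data QuadraticClass (x : Carrier) : Set where
    isZero      : x ≡ 0# → QuadraticClass x
    isSquare    : x ≢ 0# → IsSquare x → QuadraticClass x
    isNonSquare : NonSquare x → QuadraticClass x

  classify : ∀ x → QuadraticClass x
  classify x with x ≟ 0#
  ... | yes x≡0 = isZero x≡0
  ... | no x≢0 with square? x
  ... | yes x-sq = isSquare x≢0 x-sq
  ... | no x-ns = isNonSquare x-ns

  χ-zero : ∀ {x} → x ≡ 0# → χ x ≡ 0ℤ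
  χ-zero {x} x≡0 with x ≟ 0#
  ... | yes _ = refl
  ... | no x≢0 = contradiction x≡0 x≢0

  χ-square : ∀ {x} → x ≢ 0# → IsSquare x → χ x ≡ 1ℤ
  χ-square {x} x≢0 x-sq with x ≟ 0#
  ... | yes x≡0 = contradiction x≡0 x≢0
  ... | no _ with square? x
  ... | yes _ = refl
  ... | no x-ns = contradiction x-sq x-ns

  χ-nonsquare : ∀ {x} → NonSquare x → χ x ≡ -1ℤ
  χ-nonsquare {x} x-ns with x ≟ 0#
  ... | yes x≡0 = contradiction (subst IsSquare (sym x≡0) square-0) x-ns
  ... | no _ with square? x
  ... | yes x-sq = contradiction x-sq x-ns
  ... | no _ = refl

module ModFour where

  open import Data.Nat.DivMod using (m∣n⇒o%n%m≡o%m; m*n%n≡0; [m+kn]%n≡m%n)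
  open import Data.Nat.Divisibility using (divides)
  open import Data.Nat.Tactic.RingSolver using (solve-∀)

  m%4≡1⇒m≢k+k : ∀ {m} k → m % 4 ≡ 1 → m ≢ k ℕ.+ k
  m%4≡1⇒m≢k+k k m%4≡1 refl = ℕ.0≢1+n (begin
    0                        ≡⟨ sym (m*n%n≡0 k 2) ⟩
    (k ℕ.* 2) % 2            ≡⟨ cong (_% 2) (k*2≡k+k k) ⟩
    (k ℕ.+ k) % 2            ≡⟨ sym (m∣n⇒o%n%m≡o%m 2 4 (k ℕ.+ k) (divides 2 refl)) ⟩
    (k ℕ.+ k) % 4 % 2        ≡⟨ cong (_% 2) m%4≡1 ⟩
    1                        ∎)
    where
    open ≡-Reasoning
    k*2≡k+k : ∀ k → k ℕ.* 2 ≡ k ℕ.+ k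
    k*2≡k+k = solve-∀

  m%4≡1⇒m≢2[2k+1]+1 : ∀ {m} k → m % 4 ≡ 1 → m ≢ ((k ℕ.+ k) ℕ.+ 1 ℕ.+ ((k ℕ.+ k) ℕ.+ 1)) ℕ.+ 1
  m%4≡1⇒m≢2[2k+1]+1 {m} k m%4≡1 m≡ = contradiction (begin
    3                        ≡⟨ sym ([m+kn]%n≡m%n 3 k 4) ⟩
    (3 ℕ.+ k ℕ.* 4) % 4      ≡⟨ cong (_% 4) (sym (trans m≡ (≡3+k*4 k))) ⟩
    m % 4                    ≡⟨ m%4≡1 ⟩
    1                        ∎) λ ()
    where
    open ≡-Reasoning
    ≡3+k*4 : ∀ k → ((k ℕ.+ k) ℕ.+ 1 ℕ.+ ((k ℕ.+ k) ℕ.+ 1)) ℕ.+ 1 ≡ 3 ℕ.+ k ℕ.* 4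
    ≡3+k*4 = solve-∀

module QuadraticResidues (F : FiniteField) (q≡1[4] : FiniteField.order F % 4 ≡ 1) where

  open FieldProperties F
  open Cardinality
  open Enumeration _≟_ elements elements-unique elements-complete
  open ModFour
  open ≡-Reasoning

  private
    HasSize-Carrier : HasSize (λ (_ : Carrier) → ⊤) order
    HasSize-Carrier = elements , elements-unique , (λ a → mk⇔ (λ _ → tt) (λ _ → elements-complete a)) , refl

  -- Otherwise x ↦ x + 1 would be a fixed-point-free involution, and q would be even.
  1+1≢0 : 1# + 1# ≢ 0#
  1+1≢0 1+1≡0 = m%4≡1⇒m≢k+k (length (filter representative? elements)) q≡1[4]
    (HasSize-unique HasSize-Carrier (HasSize-orbits (HasSize-filter representative?)))
    where
    +1-involutive : ∀ x → ⊤ → (x + 1#) + 1# ≡ x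
    +1-involutive x _ = trans (+-assoc x 1# 1#) (trans (cong (x +_) 1+1≡0) (+-identityʳ x))
    +1-fixed-point-free : ∀ x → ⊤ → x + 1# ≢ x
    +1-fixed-point-free x _ x+1≡x = 1≢0 (begin
      1#              ≡⟨ solve 2 (λ x o → o := (x :+ o) :- x) refl x 1# ⟩
      (x + 1#) - x    ≡⟨ cong (_- x) x+1≡x ⟩
      x - x           ≡⟨ -‿inverseʳ x ⟩
      0#              ∎)
    open Orbits (_+ 1#) (λ _ _ → tt) +1-involutive +1-fixed-point-free
    representative? = Representative? (λ _ → yes tt)

  -x≢x : ∀ {x} → x ≢ 0# → - x ≢ x
  -x≢x {x} x≢0 -x≡x = x*y≢0 1+1≢0 x≢0 (begin
    (1# + 1#) * x   ≡⟨ solve 1 (λ x → (con 1ℤ :+ con 1ℤ) :* x := x :- :- x) refl x ⟩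
    x - - x         ≡⟨ cong (λ t → x - t) -x≡x ⟩
    x - x           ≡⟨ -‿inverseʳ x ⟩
    0#              ∎)

  NonzeroSquare : Carrier → Set
  NonzeroSquare x = IsSquare x × x ≢ 0#

  nonzero? : Decidable (_≢ 0#)
  nonzero? x = ¬? (x ≟ 0#)

  nonzero-square? : Decidable NonzeroSquare
  nonzero-square? x = square? x ×-dec nonzero? x

  nonsquare? : Decidable NonSquare
  nonsquare? x = ¬? (square? x)

  #nonzero #squares #nonsquares : ℕ
  #nonzero = length (filter nonzero? elements)
  #squares = length (filter nonzero-square? elements)
  #nonsquares = length (filter nonsquare? elements)

  order≡#nonzero+1 : order ≡ #nonzero ℕ.+ 1
  order≡#nonzero+1 = HasSize-unique HasSize-Carrier
    (HasSize-⊎ (HasSize-filter nonzero?) (HasSize-≡ 0#) (λ _ → id) cover (λ _ _ → tt) (λ _ _ → tt))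
    where
    cover : ∀ x → ⊤ → x ≢ 0# ⊎ x ≡ 0#
    cover x _ with x ≟ 0#
    ... | yes x≡0 = inj₂ x≡0
    ... | no x≢0 = inj₁ x≢0

  -- Pairing x with -x, squaring is a bijection from orbit representatives onto the nonzero squares.
  #nonzero≡#squares+#squares : #nonzero ≡ #squares ℕ.+ #squares
  #nonzero≡#squares+#squares = HasSize-unique (HasSize-filter nonzero?)
    (HasSize-orbits (HasSize-bijection root (λ x → x * x) root-Representative squared-Representative
      root-squared root-of-square (HasSize-filter nonzero-square?)))
    where
    open Orbits {D = _≢ 0#} -_ (λ _ → -x≢0) (λ x _ → -‿involutive x) (λ _ → -x≢x)

    root-from : ∀ s → Dec (IsSquare s) → Carrier
    root-from s (yes (z , _)) = representative z
    root-from s (no _) = s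

    root : Carrier → Carrier
    root s = root-from s (square? s)

    root-Representative : ∀ s → NonzeroSquare s → Representative (root s)
    root-Representative s = go (square? s)
      where
      go : (d : Dec (IsSquare s)) → NonzeroSquare s → Representative (root-from s d)
      go (yes (z , z*z≡s)) (_ , s≢0) = representative-Representative z (square-root≢0 z*z≡s s≢0)
      go (no s-ns) (s-sq , _) = contradiction s-sq s-ns

    root-squared : ∀ s → NonzeroSquare s → root s * root s ≡ s
    root-squared s = go (square? s)
      where
      go : (d : Dec (IsSquare s)) → NonzeroSquare s → root-from s d * root-from s d ≡ s
      go (no s-ns) (s-sq , _) = contradiction s-sq s-ns
      go (yes (z , z*z≡s)) _ = squared (representative-∈-orbit z)
        where
        squared : ∀ {r} → r ≡ z ⊎ r ≡ - z → r * r ≡ s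
        squared (inj₁ refl) = z*z≡s
        squared (inj₂ refl) = trans (-x*-y≡x*y z z) z*z≡s

    squared-Representative : ∀ x → Representative x → NonzeroSquare (x * x)
    squared-Representative x (x≢0 , _) = (x , refl) , x*y≢0 x≢0 x≢0

    root-of-square : ∀ x → Representative x → root (x * x) ≡ x
    root-of-square x rep = go (square? (x * x))
      where
      go : (d : Dec (IsSquare (x * x))) → root-from (x * x) d ≡ x
      go (no xx-ns) = contradiction (x , refl) xx-ns
      go (yes (z , z*z≡x*x)) = from-orbit (x*x≡y*y⇒x≡y⊎x≡-y z*z≡x*x)
        where
        from-orbit : z ≡ x ⊎ z ≡ - x → representative z ≡ x
        from-orbit (inj₁ refl) = representative-self x rep
        from-orbit (inj₂ refl) = representative-σ x rep

  #nonzero≡#squares+#nonsquares : #nonzero ≡ #squares ℕ.+ #nonsquares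
  #nonzero≡#squares+#nonsquares = HasSize-unique (HasSize-filter nonzero?)
    (HasSize-⊎ (HasSize-filter nonzero-square?) (HasSize-filter nonsquare?) (λ _ sq ns → ns (proj₁ sq))
      cover (λ _ → proj₂) (λ _ → nonsquare⇒≢0))
    where
    cover : ∀ x → x ≢ 0# → NonzeroSquare x ⊎ NonSquare x
    cover x x≢0 with square? x
    ... | yes x-sq = inj₁ (x-sq , x≢0)
    ... | no x-ns = inj₂ x-ns

  #nonsquares≡#squares : #nonsquares ≡ #squares
  #nonsquares≡#squares = ℕ.+-cancelˡ-≡ #squares _ _ (trans (sym #nonzero≡#squares+#nonsquares) #nonzero≡#squares+#squares)

  -- m times the nonzero squares are #squares = #nonsquares distinct nonsquares, hence all of them.
  nonsquare*nonsquare : ∀ {m n} → NonSquare m → NonSquare n → IsSquare (m * n)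
  nonsquare*nonsquare {m} {n} m-ns n-ns = square-of-product (∈-map⁻ (m *_) n∈mQ)
    where
    squares = filter nonzero-square? elements
    square-of : ∀ {s} → s ∈ squares → NonzeroSquare s
    square-of s∈ = proj₂ (∈-filter⁻ nonzero-square? {xs = elements} s∈)
    mQ⊆N : ∀ y → y ∈ map (m *_) squares → NonSquare y
    mQ⊆N y y∈ with ∈-map⁻ (m *_) y∈
    ... | s , s∈ , refl = nonsquare-*ʳ (proj₁ (square-of s∈)) (proj₂ (square-of s∈)) m-ns
    mQ-unique : Unique (map (m *_) squares)
    mQ-unique = Unique.map⁺ (*-cancelˡ (nonsquare⇒≢0 m-ns)) (Unique.filter⁺ nonzero-square? {elements} elements-unique)
    n∈mQ : n ∈ map (m *_) squares
    n∈mQ = pigeonhole mQ-unique mQ⊆N (HasSize-filter nonsquare?)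
      (ℕ.≤-reflexive (trans #nonsquares≡#squares (sym (length-map (m *_) squares)))) n n-ns
    square-of-product : ∃[ s ] (s ∈ squares × n ≡ m * s) → IsSquare (m * n)
    square-of-product (s , s∈ , refl) = subst IsSquare (*-assoc m m s) (square-* (m , refl) (proj₁ (square-of s∈)))

  ∃-nonsquare : Σ Carrier NonSquare
  ∃-nonsquare with filter nonsquare? elements in eq
  ... | g ∷ _ = g , proj₂ (∈-filter⁻ nonsquare? {xs = elements} (subst (g ∈_) (sym eq) (here refl)))
  ... | [] = contradiction (trans (cong length (sym eq)) #nonsquares≡#squares) (ℕ.<⇒≢ 0<#squares)
    where
    0<#squares : 0 ℕ.< #squares
    0<#squares with filter nonzero-square? elements | ∈-filter⁺ nonzero-square? (elements-complete 1#) (square-1 , 1≢0)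
    ... | _ ∷ _ | _ = ℕ.z<s

  -- Otherwise x ↦ x⁻¹ pairs off the nonzero squares other than 1, so #squares is odd and q ≡ 3 (mod 4).
  -1-square : IsSquare (- 1#)
  -1-square with square? (- 1#)
  ... | yes -1-sq = -1-sq
  ... | no -1-ns = ⊥-elim (m%4≡1⇒m≢2[2k+1]+1 k q≡1[4] (begin
    order                            ≡⟨ order≡#nonzero+1 ⟩
    #nonzero ℕ.+ 1                   ≡⟨ cong (ℕ._+ 1) #nonzero≡#squares+#squares ⟩
    #squares ℕ.+ #squares ℕ.+ 1      ≡⟨ cong (λ k → k ℕ.+ k ℕ.+ 1) #squares≡2k+1 ⟩
    (k ℕ.+ k ℕ.+ 1) ℕ.+ (k ℕ.+ k ℕ.+ 1) ℕ.+ 1 ∎))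
    where
    D : Carrier → Set
    D x = NonzeroSquare x × x ≢ 1#
    ⁻¹-closed : ∀ x → D x → D (x ⁻¹)
    ⁻¹-closed x ((x-sq , x≢0) , x≢1) = (square-⁻¹ x-sq x≢0 , x⁻¹≢0 x≢0) ,
      λ x⁻¹≡1 → x≢1 (trans (sym (⁻¹-involutive x≢0)) (trans (cong _⁻¹ x⁻¹≡1) 1⁻¹≡1))
    ⁻¹-fixed-point-free : ∀ x → D x → x ⁻¹ ≢ x
    ⁻¹-fixed-point-free x ((x-sq , x≢0) , x≢1) x⁻¹≡x
      with x*x≡y*y⇒x≡y⊎x≡-y (trans (cong (x *_) (sym x⁻¹≡x)) (trans (inverseʳ x x≢0) (sym (*-identityˡ 1#))))
    ... | inj₁ x≡1 = x≢1 x≡1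
    ... | inj₂ x≡-1 = -1-ns (subst IsSquare x≡-1 x-sq)
    open Orbits {D = D} _⁻¹ ⁻¹-closed (λ x d → ⁻¹-involutive (proj₂ (proj₁ d))) ⁻¹-fixed-point-free
    representative? = Representative? (λ x → nonzero-square? x ×-dec ¬? (x ≟ 1#))
    k = length (filter representative? elements)
    #squares≡2k+1 : #squares ≡ (k ℕ.+ k) ℕ.+ 1
    #squares≡2k+1 = HasSize-unique (HasSize-filter nonzero-square?)
      (HasSize-⊎ (HasSize-orbits (HasSize-filter representative?)) (HasSize-≡ 1#) (λ _ d x≡1 → proj₂ d x≡1) cover
        (λ _ → proj₁) (λ { _ refl → square-1 , 1≢0 }))
      where
      cover : ∀ x → NonzeroSquare x → D x ⊎ x ≡ 1#
      cover x sq with x ≟ 1#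
      ... | yes x≡1 = inj₂ x≡1
      ... | no x≢1 = inj₁ (sq , x≢1)

module QuadraticCharacter (F : FiniteField) (q≡1[4] : FiniteField.order F % 4 ≡ 1) where

  open FieldProperties F
  open QuadraticResidues F q≡1[4] using (nonsquare*nonsquare; -1-square)
  open ≡-Reasoning

  χ-* : ∀ x y → χ (x * y) ≡ χ x ℤ.* χ y
  χ-* x y with classify x | classify y
  ... | isZero x≡0 | _ = trans (χ-zero (trans (cong (_* y) x≡0) (zeroˡ y))) (cong (ℤ._* χ y) (sym (χ-zero x≡0)))
  ... | _ | isZero y≡0 = trans (χ-zero (trans (cong (x *_) y≡0) (zeroʳ x))) (trans (sym (ℤ.*-zeroʳ (χ x))) (cong (χ x ℤ.*_) (sym (χ-zero y≡0))))
  ... | isSquare x≢0 x-sq | isSquare y≢0 y-sq =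
    trans (χ-square (x*y≢0 x≢0 y≢0) (square-* x-sq y-sq)) (sym (cong₂ ℤ._*_ (χ-square x≢0 x-sq) (χ-square y≢0 y-sq)))
  ... | isSquare x≢0 x-sq | isNonSquare y-ns =
    trans (χ-nonsquare (nonsquare-*ˡ x-sq x≢0 y-ns)) (sym (cong₂ ℤ._*_ (χ-square x≢0 x-sq) (χ-nonsquare y-ns)))
  ... | isNonSquare x-ns | isSquare y≢0 y-sq =
    trans (χ-nonsquare (nonsquare-*ʳ y-sq y≢0 x-ns)) (sym (cong₂ ℤ._*_ (χ-nonsquare x-ns) (χ-square y≢0 y-sq)))
  ... | isNonSquare x-ns | isNonSquare y-ns =
    trans (χ-square (x*y≢0 (nonsquare⇒≢0 x-ns) (nonsquare⇒≢0 y-ns)) (nonsquare*nonsquare x-ns y-ns))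
      (sym (cong₂ ℤ._*_ (χ-nonsquare x-ns) (χ-nonsquare y-ns)))

  χ-sign : ∀ {x} → x ≢ 0# → χ x ≡ 1ℤ ⊎ χ x ≡ -1ℤ
  χ-sign {x} x≢0 with classify x
  ... | isZero x≡0 = contradiction x≡0 x≢0
  ... | isSquare x≢0 x-sq = inj₁ (χ-square x≢0 x-sq)
  ... | isNonSquare x-ns = inj₂ (χ-nonsquare x-ns)

  χ≡1⇒square : ∀ {x} → χ x ≡ 1ℤ → IsSquare x
  χ≡1⇒square {x} χx≡1 with classify x
  ... | isZero x≡0 = contradiction (trans (sym χx≡1) (χ-zero x≡0)) λ ()
  ... | isSquare _ x-sq = x-sq
  ... | isNonSquare x-ns = contradiction (trans (sym χx≡1) (χ-nonsquare x-ns)) λ ()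

  χ≡-1⇒nonsquare : ∀ {x} → χ x ≡ -1ℤ → NonSquare x
  χ≡-1⇒nonsquare {x} χx≡-1 x-sq with classify x
  ... | isZero x≡0 = contradiction (trans (sym χx≡-1) (χ-zero x≡0)) λ ()
  ... | isSquare x≢0 _ = contradiction (trans (sym χx≡-1) (χ-square x≢0 x-sq)) λ ()
  ... | isNonSquare x-ns = x-ns x-sq

  χ-neg : ∀ z → χ (- z) ≡ χ z
  χ-neg z = begin
    χ (- z)               ≡⟨ cong χ (sym (-1*x≈-x z)) ⟩
    χ (- 1# * z)          ≡⟨ χ-* (- 1#) z ⟩
    χ (- 1#) ℤ.* χ z      ≡⟨ cong (ℤ._* χ z) (χ-square (-x≢0 1≢0) -1-square) ⟩
    1ℤ ℤ.* χ z            ≡⟨ ℤ.*-identityˡ (χ z) ⟩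
    χ z                   ∎

  χ-*-square : ∀ {s} z → IsSquare s → s ≢ 0# → χ (s * z) ≡ χ z
  χ-*-square {s} z s-sq s≢0 = trans (χ-* s z) (trans (cong (ℤ._* χ z) (χ-square s≢0 s-sq)) (ℤ.*-identityˡ (χ z)))

  χ-neg-*-square : ∀ {s} z → IsSquare s → s ≢ 0# → χ (- (s * z)) ≡ χ z
  χ-neg-*-square z s-sq s≢0 = trans (χ-neg _) (χ-*-square z s-sq s≢0)

  χ≡χ⇒square-* : ∀ {s t} → s ≢ 0# → χ s ≡ χ t → IsSquare (s * t)
  χ≡χ⇒square-* {s} {t} s≢0 χs≡χt = χ≡1⇒square (begin
    χ (s * t)          ≡⟨ χ-* s t ⟩
    χ s ℤ.* χ t        ≡⟨ cong (χ s ℤ.*_) (sym χs≡χt) ⟩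
    χ s ℤ.* χ s        ≡⟨ [ (λ e → cong (λ k → k ℤ.* k) e) , (λ e → cong (λ k → k ℤ.* k) e) ]′ (χ-sign s≢0) ⟩
    1ℤ                 ∎)

  χ*χ≡-1⇒nonsquare-* : ∀ {s t} → χ s ℤ.* χ t ≡ -1ℤ → NonSquare (s * t)
  χ*χ≡-1⇒nonsquare-* {s} {t} e = χ≡-1⇒nonsquare (trans (χ-* s t) e)

  square-neg : ∀ {z} → IsSquare z → IsSquare (- z)
  square-neg {z} z-sq = subst IsSquare (-1*x≈-x z) (square-* -1-square z-sq)

  nonsquare-neg : ∀ {z} → NonSquare z → NonSquare (- z)
  nonsquare-neg {z} z-ns -z-sq = z-ns (subst IsSquare (-‿involutive z) (square-neg -z-sq))

  ε-≢-neg : ∀ {x y} → x ≢ y → χ (x - y) ≢ ℤ.- χ (x - y)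
  ε-≢-neg x≢y e with χ-sign (x≢y⇒x-y≢0 x≢y)
  ... | inj₁ χ≡1 = contradiction (trans (sym χ≡1) (trans e (cong ℤ.-_ χ≡1))) λ ()
  ... | inj₂ χ≡-1 = contradiction (trans (sym χ≡-1) (trans e (cong ℤ.-_ χ≡-1))) λ ()

module Obstructions (F : FiniteField) (q≡1[4] : FiniteField.order F % 4 ≡ 1) where

  open FieldProperties F
  open QuadraticResidues F q≡1[4] using (-1-square)
  open QuadraticCharacter F q≡1[4]
  open ≡-Reasoning

  -- Bad p holds iff p lies in the union of the S_{ij}^{rs}.
  Bad : Point → Set
  Bad p = ∃[ ab ] ∃[ uv ] (InΣ ab × Ψ ab ≡ p × InE ab uv)

  InT⇒¬Bad : ∀ {p} → InT p → ¬ Bad p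
  InT⇒¬Bad (_ , ∉Sᵢⱼʳˢ) (ab , (u , v) , ab∈Σ , Ψab≡p , uv∈E) =
    ∉Sᵢⱼʳˢ _ _ _ _ (ab , (ab∈Σ , (u , v) , uv∈E , class u , class (- v) , class (ψ ab u - v) , class (u - v - ψ ab (- v))) , Ψab≡p)
    where
    index : Carrier → Fin 2
    index z with square? z
    ... | yes _ = zero
    ... | no _ = suc zero
    class : ∀ z → Cls (index z) z
    class z with square? z
    ... | yes z-sq = z-sq
    ... | no z-ns = z-ns

  InS∧¬Bad⇒InT : ∀ {p} → InS p → ¬ Bad p → InT p
  InS∧¬Bad⇒InT p∈S ¬bad = p∈S , λ { _ _ _ _ (ab , (ab∈Σ , uv , uv∈E , _) , Ψab≡p) → ¬bad (ab , uv , ab∈Σ , Ψab≡p , uv∈E) }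

  1-x≢0 : ∀ {x} → x ≢ 1# → 1# - x ≢ 0#
  1-x≢0 x≢1 = x≢y⇒x-y≢0 (x≢1 ∘ sym)

  1-x≢0⇒x≢1 : ∀ {x} → 1# - x ≢ 0# → x ≢ 1#
  1-x≢0⇒x≢1 1-x≢0 x≡1 = 1-x≢0 (trans (cong (λ t → 1# - t) x≡1) (-‿inverseʳ 1#))

  -- The preimage (a , b) of a point (x , y) of S under Ψ. Each identity below holds as a
  -- polynomial identity in x, y, w modulo (x - y) w - 1, with the multiplier given to the solver.
  module Preimage {x y : Carrier} (x-sq : IsSquare x) (y-sq : IsSquare y) (x≢y : x ≢ y)
    (x≢0 : x ≢ 0#) (x≢1 : x ≢ 1#) (y≢0 : y ≢ 0#) (y≢1 : y ≢ 1#) where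

    w b a : Carrier
    w = (x - y) ⁻¹
    b = (1# - y) * w
    a = x * b

    hw : (x - y) * w ≡ 1#
    hw = inverseʳ (x - y) (x≢y⇒x-y≢0 x≢y)

    w≢0 : w ≢ 0#
    w≢0 = x⁻¹≢0 (x≢y⇒x-y≢0 x≢y)

    1-a≡y[1-b] : 1# - a ≡ y * (1# - b)
    1-a≡y[1-b] = x≡y+c*[k-1]⇒k≡1⇒x≡y (solve 3 (λ x y w → ((con 1ℤ) :- (x :* (((con 1ℤ) :- y) :* w))) := ((y :* ((con 1ℤ) :- (((con 1ℤ) :- y) :* w))) :+ (((con -1ℤ) :+ ((con 1ℤ) :* y)) :* (((x :- y) :* w) :- (con 1ℤ))))) refl x y w) hw

    1-b≡[x-1]w : 1# - b ≡ (x - 1#) * w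
    1-b≡[x-1]w = x≡y+c*[k-1]⇒k≡1⇒x≡y (solve 3 (λ x y w → ((con 1ℤ) :- (((con 1ℤ) :- y) :* w)) := (((x :- (con 1ℤ)) :* w) :+ ((con -1ℤ) :* (((x :- y) :* w) :- (con 1ℤ))))) refl x y w) hw

    a≡xw²[1-y][x-y] : a ≡ (x * (w * w)) * ((1# - y) * (x - y))
    a≡xw²[1-y][x-y] = x≡y+c*[k-1]⇒k≡1⇒x≡y (solve 3 (λ x y w → (x :* (((con 1ℤ) :- y) :* w)) := (((x :* (w :* w)) :* (((con 1ℤ) :- y) :* (x :- y))) :+ ((((con -1ℤ) :* x :* w) :+ ((con 1ℤ) :* x :* y :* w)) :* (((x :- y) :* w) :- (con 1ℤ))))) refl x y w) hw

    a-1≡yw²[1-x][x-y] : a * 1# - 1# ≡ (y * (w * w)) * ((1# - x) * (x - y))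
    a-1≡yw²[1-x][x-y] = x≡y+c*[k-1]⇒k≡1⇒x≡y (solve 3 (λ x y w → (((x :* (((con 1ℤ) :- y) :* w)) :* (con 1ℤ)) :- (con 1ℤ)) := (((y :* (w :* w)) :* (((con 1ℤ) :- x) :* (x :- y))) :+ (((con 1ℤ) :+ ((con -1ℤ) :* y :* w) :+ ((con 1ℤ) :* x :* y :* w)) :* (((x :- y) :* w) :- (con 1ℤ))))) refl x y w) hw

    ax-y≡-w²[x-y]f₄ : a * x - y ≡ - ((w * w) * ((x - y) * f₄ (x , y)))
    ax-y≡-w²[x-y]f₄ = x≡y+c*[k-1]⇒k≡1⇒x≡y (solve 3 (λ x y w → (((x :* (((con 1ℤ) :- y) :* w)) :* x) :- y) := ((:- ((w :* w) :* ((x :- y) :* (((((x :* x) :* y) :+ (x :* y)) :- (x :* x)) :- (y :* y))))) :+ ((((con 1ℤ) :* y) :+ ((con -1ℤ) :* y :* y :* w) :+ ((con 1ℤ) :* x :* y :* w) :+ ((con -1ℤ) :* x :* x :* w) :+ ((con 1ℤ) :* x :* x :* y :* w)) :* (((x :- y) :* w) :- (con 1ℤ))))) refl x y w) hw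

    x-y+ay≡-w²[x-y]f₃ : x - y - a * (- y) ≡ - ((w * w) * ((x - y) * f₃ (x , y)))
    x-y+ay≡-w²[x-y]f₃ = x≡y+c*[k-1]⇒k≡1⇒x≡y (solve 3 (λ x y w → ((x :- y) :- ((x :* (((con 1ℤ) :- y) :* w)) :* (:- y))) := ((:- ((w :* w) :* ((x :- y) :* (((((y :* y) :* x) :+ (x :* y)) :- (x :* x)) :- (y :* y))))) :+ ((((con 1ℤ) :* y) :+ ((con -1ℤ) :* y :* y :* w) :+ ((con -1ℤ) :* x) :+ ((con 1ℤ) :* x :* y :* w) :+ ((con 1ℤ) :* x :* y :* y :* w) :+ ((con -1ℤ) :* x :* x :* w)) :* (((x :- y) :* w) :- (con 1ℤ))))) refl x y w) hw

    b[ax-y]≡a[-y]+b[x-y+ay] : b * (a * x - y) ≡ a * (- y) + b * (x - y - a * (- y))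
    b[ax-y]≡a[-y]+b[x-y+ay] = x≡y+c*[k-1]⇒k≡1⇒x≡y (solve 3 (λ x y w → ((((con 1ℤ) :- y) :* w) :* (((x :* (((con 1ℤ) :- y) :* w)) :* x) :- y)) := ((((x :* (((con 1ℤ) :- y) :* w)) :* (:- y)) :+ ((((con 1ℤ) :- y) :* w) :* ((x :- y) :- ((x :* (((con 1ℤ) :- y) :* w)) :* (:- y))))) :+ ((((con 1ℤ) :* x :* w) :+ ((con -[1+ 1 ]) :* x :* y :* w) :+ ((con 1ℤ) :* x :* y :* y :* w)) :* (((x :- y) :* w) :- (con 1ℤ))))) refl x y w) hw

    b≢0 : b ≢ 0#
    b≢0 = x*y≢0 (1-x≢0 y≢1) w≢0

    1-b≢0 : 1# - b ≢ 0#
    1-b≢0 1-b≡0 = x*y≢0 (x≢y⇒x-y≢0 x≢1) w≢0 (trans (sym 1-b≡[x-1]w) 1-b≡0)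

    [a,b]∈Σ : InΣ (a , b)
    [a,b]∈Σ = (λ a≡b → x≢1 (*-cancelˡ b≢0 (trans (*-comm b x) (trans a≡b (sym (*-identityʳ b))))))
            , x*y≢0 x≢0 b≢0
            , 1-x≢0⇒x≢1 (λ 1-a≡0 → x*y≢0 y≢0 1-b≢0 (trans (sym 1-a≡y[1-b]) 1-a≡0))
            , b≢0
            , 1-x≢0⇒x≢1 1-b≢0
            , subst IsSquare (sym (*-assoc x b b)) (square-* x-sq (b , refl))
            , subst IsSquare (cong (_* (1# - b)) (sym 1-a≡y[1-b]))
                (subst IsSquare (sym (*-assoc y _ _)) (square-* y-sq (1# - b , refl)))

    Ψ[a,b]≡[x,y] : Ψ (a , b) ≡ (x , y)
    Ψ[a,b]≡[x,y] = cong₂ _,_ (x*y*y⁻¹≡x b≢0) (trans (cong (_* (1# - b) ⁻¹) 1-a≡y[1-b]) (x*y*y⁻¹≡x 1-b≢0))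

    -- (u , v) = (1 , 1) solves the equation of E(a , b) when a and a - 1 are squares.
    Bad-if-χ[1-x]≡χ[1-y]≡ε : χ (1# - x) ≡ ε (x , y) → χ (1# - y) ≡ ε (x , y) → Bad (x , y)
    Bad-if-χ[1-x]≡χ[1-y]≡ε χ[1-x]≡ε χ[1-y]≡ε = (a , b) , (1# , 1#) , [a,b]∈Σ , Ψ[a,b]≡[x,y] , [1,1]≢0 , equation
      where
      a-sq : IsSquare a
      a-sq = subst IsSquare (sym a≡xw²[1-y][x-y]) (square-* (square-* x-sq (w , refl)) (χ≡χ⇒square-* (1-x≢0 y≢1) χ[1-y]≡ε))
      a-1-sq : IsSquare (a * 1# - 1#)
      a-1-sq = subst IsSquare (sym a-1≡yw²[1-x][x-y]) (square-* (square-* y-sq (w , refl)) (χ≡χ⇒square-* (1-x≢0 x≢1) χ[1-x]≡ε))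
      a′-sq : IsSquare (1# - 1# - a * (- 1#))
      a′-sq = subst IsSquare (solve 1 (λ a → a := con 1ℤ :- con 1ℤ :- a :* :- con 1ℤ) refl a) a-sq
      [1,1]≢0 : (1# , 1#) ≢ (0# , 0#)
      [1,1]≢0 e = 1≢0 (cong proj₁ e)
      ψab = ψ (a , b)
      equation : ψab (ψab 1# - 1#) ≡ ψab (- 1#) + ψab (1# - 1# - ψab (- 1#))
      equation = begin
        ψab (ψab 1# - 1#)                          ≡⟨ cong (λ t → ψab (t - 1#)) (ψ-square square-1) ⟩
        ψab (a * 1# - 1#)                          ≡⟨ ψ-square a-1-sq ⟩
        a * (a * 1# - 1#)                          ≡⟨ solve 1 (λ a → a :* (a :* con 1ℤ :- con 1ℤ) := a :* :- con 1ℤ :+ a :* (con 1ℤ :- con 1ℤ :- a :* :- con 1ℤ)) refl a ⟩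
        a * (- 1#) + a * (1# - 1# - a * (- 1#))    ≡⟨ cong (a * (- 1#) +_) (sym (ψ-square a′-sq)) ⟩
        a * (- 1#) + ψab (1# - 1# - a * (- 1#))    ≡⟨ cong (λ t → t + ψab (1# - 1# - t)) (sym (ψ-square -1-square)) ⟩
        ψab (- 1#) + ψab (1# - 1# - ψab (- 1#))    ∎

    -- (u , v) = (x , y) solves the equation of E(a , b) when a x - y and x - y + a y are nonsquares.
    Bad-if-ρ₃≡ρ₄≡-1 : -1ℤ ≡ ε (x , y) ℤ.* χ (f₃ (x , y)) → -1ℤ ≡ ε (x , y) ℤ.* χ (f₄ (x , y)) → Bad (x , y)
    Bad-if-ρ₃≡ρ₄≡-1 ρ₃≡-1 ρ₄≡-1 = (a , b) , (x , y) , [a,b]∈Σ , Ψ[a,b]≡[x,y] , [x,y]≢0 , equation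
      where
      [x,y]≢0 : (x , y) ≢ (0# , 0#)
      [x,y]≢0 e = x≢0 (cong proj₁ e)
      ψab = ψ (a , b)
      -w²[x-y]f-nonsquare : ∀ f → -1ℤ ≡ ε (x , y) ℤ.* χ f → NonSquare (- ((w * w) * ((x - y) * f)))
      -w²[x-y]f-nonsquare f ρ≡-1 = nonsquare-neg (nonsquare-*ˡ (w , refl) (x*y≢0 w≢0 w≢0) (χ*χ≡-1⇒nonsquare-* (sym ρ≡-1)))
      ax-y-ns : NonSquare (a * x - y)
      ax-y-ns = subst NonSquare (sym ax-y≡-w²[x-y]f₄) (-w²[x-y]f-nonsquare _ ρ₄≡-1)
      x-y+ay-ns : NonSquare (x - y - a * (- y))
      x-y+ay-ns = subst NonSquare (sym x-y+ay≡-w²[x-y]f₃) (-w²[x-y]f-nonsquare _ ρ₃≡-1)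
      equation : ψab (ψab x - y) ≡ ψab (- y) + ψab (x - y - ψab (- y))
      equation = begin
        ψab (ψab x - y)                            ≡⟨ cong (λ t → ψab (t - y)) (ψ-square x-sq) ⟩
        ψab (a * x - y)                            ≡⟨ ψ-nonsquare ax-y-ns ⟩
        b * (a * x - y)                            ≡⟨ b[ax-y]≡a[-y]+b[x-y+ay] ⟩
        a * (- y) + b * (x - y - a * (- y))        ≡⟨ cong (a * (- y) +_) (sym (ψ-nonsquare x-y+ay-ns)) ⟩
        a * (- y) + ψab (x - y - a * (- y))        ≡⟨ cong (λ t → t + ψab (x - y - t)) (sym (ψ-square (square-neg y-sq))) ⟩
        ψab (- y) + ψab (x - y - ψab (- y))        ∎

  InT⇒¬[χ[1-x]≡χ[1-y]≡ε] : ∀ {x y} → InT (x , y) → χ (1# - x) ≡ ε (x , y) → χ (1# - y) ≡ ε (x , y) → ⊥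
  InT⇒¬[χ[1-x]≡χ[1-y]≡ε] t@((x-sq , y-sq , x≢y , x≢0 , x≢1 , y≢0 , y≢1) , _) e₁ e₂ =
    InT⇒¬Bad t (Preimage.Bad-if-χ[1-x]≡χ[1-y]≡ε x-sq y-sq x≢y x≢0 x≢1 y≢0 y≢1 e₁ e₂)

  InR⇒¬[ρ₃≡ρ₄≡-1] : ∀ {ρ₁ ρ₂} p → ¬ InR ρ₁ ρ₂ -1ℤ -1ℤ p
  InR⇒¬[ρ₃≡ρ₄≡-1] p (t@((x-sq , y-sq , x≢y , x≢0 , x≢1 , y≢0 , y≢1) , _) , _ , _ , ρ₃≡-1 , ρ₄≡-1) =
    InT⇒¬Bad t (Preimage.Bad-if-ρ₃≡ρ₄≡-1 x-sq y-sq x≢y x≢0 x≢1 y≢0 y≢1 ρ₃≡-1 ρ₄≡-1)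

module Symmetries (F : FiniteField) (q≡1[4] : FiniteField.order F % 4 ≡ 1) where

  open FieldProperties F
  open QuadraticResidues F q≡1[4] using (∃-nonsquare; nonsquare*nonsquare)
  open QuadraticCharacter F q≡1[4]
  open Obstructions F q≡1[4]
  open ≡-Reasoning

  1-[1-x]≡x : ∀ x → 1# - (1# - x) ≡ x
  1-[1-x]≡x = solve 1 (λ x → con 1ℤ :- (con 1ℤ :- x) := x) refl

  1-x-injective : ∀ {x y} → 1# - x ≡ 1# - y → x ≡ y
  1-x-injective {x} {y} e = trans (sym (1-[1-x]≡x x)) (trans (cong (λ t → 1# - t) e) (1-[1-x]≡x y))

  ψ-complement : ∀ a b z → ψ (1# - a , 1# - b) z ≡ z - ψ (a , b) z
  ψ-complement a b z with square? z
  ... | yes _ = solve 2 (λ a z → (con 1ℤ :- a) :* z := z :- a :* z) refl a z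
  ... | no _ = solve 2 (λ b z → (con 1ℤ :- b) :* z := z :- b :* z) refl b z

  -- (a , b) ↦ (1 - a , 1 - b) and (u , v) ↦ (- v , - u) swap the coordinates of Ψ and preserve E.
  Bad-swap : ∀ {x y} → Bad (y , x) → Bad (x , y)
  Bad-swap ((a , b) , (u , v) , (a≢b , a≢0 , a≢1 , b≢0 , b≢1 , ab-sq , [1-a][1-b]-sq) , Ψab≡yx , uv≢0 , uv∈E) =
    (1# - a , 1# - b) , (- v , - u) , ab′∈Σ , Ψab′≡xy , -v-u≢0 , equation
    where
    ab′∈Σ : InΣ (1# - a , 1# - b)
    ab′∈Σ = a≢b ∘ 1-x-injective , 1-x≢0 a≢1 , a≢0 ∘ 1-x≡1⇒x≡0 , 1-x≢0 b≢1 , b≢0 ∘ 1-x≡1⇒x≡0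
          , [1-a][1-b]-sq , subst IsSquare (sym (cong₂ _*_ (1-[1-x]≡x a) (1-[1-x]≡x b))) ab-sq
      where
      1-x≡1⇒x≡0 : ∀ {x} → 1# - x ≡ 1# → x ≡ 0#
      1-x≡1⇒x≡0 {x} e = trans (sym (1-[1-x]≡x x)) (trans (cong (λ t → 1# - t) e) (-‿inverseʳ 1#))
    Ψab′≡xy : Ψ (1# - a , 1# - b) ≡ _
    Ψab′≡xy = cong₂ _,_ (cong proj₂ Ψab≡yx) (trans (cong₂ (λ s t → s * t ⁻¹) (1-[1-x]≡x a) (1-[1-x]≡x b)) (cong proj₁ Ψab≡yx))
    -v-u≢0 : (- v , - u) ≢ (0# , 0#)
    -v-u≢0 e = uv≢0 (cong₂ _,_ (-x≡0⇒x≡0 (cong proj₂ e)) (-x≡0⇒x≡0 (cong proj₁ e)))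
      where
      -x≡0⇒x≡0 : ∀ {x} → - x ≡ 0# → x ≡ 0#
      -x≡0⇒x≡0 {x} e = trans (sym (-‿involutive x)) (trans (cong -_ e) -0#≈0#)
    ψ₀ = ψ (a , b)
    ψ′ = ψ (1# - a , 1# - b)
    p = ψ₀ u
    q = ψ₀ (- v)
    r = ψ₀ (u - v - q)
    equation : ψ′ (ψ′ (- v) - (- u)) ≡ ψ′ (- (- u)) + ψ′ (- v - (- u) - ψ′ (- (- u)))
    equation = begin
      ψ′ (ψ′ (- v) - (- u))                    ≡⟨ cong (λ t → ψ′ (t - (- u))) (ψ-complement a b (- v)) ⟩
      ψ′ ((- v - q) - (- u))                   ≡⟨ cong ψ′ (solve 3 (λ u v q → (:- v :- q) :- (:- u) := u :- v :- q) refl u v q) ⟩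
      ψ′ (u - v - q)                           ≡⟨ ψ-complement a b _ ⟩
      (u - v - q) - r                          ≡⟨ solve 5 (λ u v p q r → (u :- v :- q) :- r := (u :- p) :+ ((p :- v) :- (q :+ r))) refl u v p q r ⟩
      (u - p) + ((p - v) - (q + r))            ≡⟨ cong (λ t → (u - p) + ((p - v) - t)) (sym uv∈E) ⟩
      (u - p) + ((p - v) - ψ₀ (p - v))         ≡⟨ cong ((u - p) +_) (sym (ψ-complement a b (p - v))) ⟩
      (u - p) + ψ′ (p - v)                     ≡⟨ cong (λ t → (u - p) + ψ′ t) (solve 3 (λ u v p → p :- v := :- v :- (:- u) :- (u :- p)) refl u v p) ⟩
      (u - p) + ψ′ (- v - (- u) - (u - p))     ≡⟨ cong (λ t → t + ψ′ (- v - (- u) - t)) (sym (ψ-complement a b u)) ⟩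
      ψ′ u + ψ′ (- v - (- u) - ψ′ u)           ≡⟨ cong (λ t → ψ′ t + ψ′ (- v - (- u) - ψ′ t)) (sym (-‿involutive u)) ⟩
      ψ′ (- (- u)) + ψ′ (- v - (- u) - ψ′ (- (- u))) ∎

  g : Carrier
  g = proj₁ ∃-nonsquare

  g-ns : NonSquare g
  g-ns = proj₂ ∃-nonsquare

  g≢0 : g ≢ 0#
  g≢0 = nonsquare⇒≢0 g-ns

  -- Multiplication by a nonsquare exchanges squares and nonsquares.
  ψ-flip : ∀ a b z → ψ (b , a) (g * z) ≡ g * ψ (a , b) z
  ψ-flip a b z with classify z
  ... | isZero refl = begin
    ψ (b , a) (g * 0#)     ≡⟨ cong (ψ (b , a)) (zeroʳ g) ⟩
    ψ (b , a) 0#           ≡⟨ ψ-square square-0 ⟩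
    b * 0#                 ≡⟨ solve 3 (λ a b g → b :* con 0ℤ := g :* (a :* con 0ℤ)) refl a b g ⟩
    g * (a * 0#)           ≡⟨ cong (g *_) (sym (ψ-square square-0)) ⟩
    g * ψ (a , b) 0#       ∎
  ... | isSquare z≢0 z-sq = trans (ψ-nonsquare (nonsquare-*ʳ z-sq z≢0 g-ns))
    (trans (solve 3 (λ a g z → a :* (g :* z) := g :* (a :* z)) refl a g z) (cong (g *_) (sym (ψ-square z-sq))))
  ... | isNonSquare z-ns = trans (ψ-square (nonsquare*nonsquare g-ns z-ns))
    (trans (solve 3 (λ b g z → b :* (g :* z) := g :* (b :* z)) refl b g z) (cong (g *_) (sym (ψ-nonsquare z-ns))))

  a*b⁻¹≡x⁻¹⇒b*a⁻¹≡x : ∀ {a b x} → a ≢ 0# → b ≢ 0# → x ≢ 0# → a * b ⁻¹ ≡ x ⁻¹ → b * a ⁻¹ ≡ x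
  a*b⁻¹≡x⁻¹⇒b*a⁻¹≡x {a} {b} {x} a≢0 b≢0 x≢0 e = begin
    b * a ⁻¹              ≡⟨ *-comm b _ ⟩
    a ⁻¹ * b              ≡⟨ cong (a ⁻¹ *_) (sym (⁻¹-involutive b≢0)) ⟩
    a ⁻¹ * (b ⁻¹) ⁻¹      ≡⟨ sym (⁻¹-distrib-* a≢0 (x⁻¹≢0 b≢0)) ⟩
    (a * b ⁻¹) ⁻¹         ≡⟨ cong _⁻¹ e ⟩
    (x ⁻¹) ⁻¹             ≡⟨ ⁻¹-involutive x≢0 ⟩
    x                     ∎

  -- (a , b) ↦ (b , a) inverts Ψ, and (u , v) ↦ (g u , g v) with g a nonsquare preserves E.
  Bad-invert : ∀ {x y} → x ≢ 0# → y ≢ 0# → Bad (x ⁻¹ , y ⁻¹) → Bad (x , y)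
  Bad-invert x≢0 y≢0 ((a , b) , (u , v) , (a≢b , a≢0 , a≢1 , b≢0 , b≢1 , ab-sq , [1-a][1-b]-sq) , Ψab≡x⁻¹y⁻¹ , uv≢0 , uv∈E) =
    (b , a) , (g * u , g * v) , ba∈Σ , Ψba≡xy , guv≢0 , equation
    where
    ba∈Σ : InΣ (b , a)
    ba∈Σ = a≢b ∘ sym , b≢0 , b≢1 , a≢0 , a≢1 , subst IsSquare (*-comm a b) ab-sq , subst IsSquare (*-comm (1# - a) (1# - b)) [1-a][1-b]-sq
    Ψba≡xy : Ψ (b , a) ≡ _
    Ψba≡xy = cong₂ _,_ (a*b⁻¹≡x⁻¹⇒b*a⁻¹≡x a≢0 b≢0 x≢0 (cong proj₁ Ψab≡x⁻¹y⁻¹))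
                       (a*b⁻¹≡x⁻¹⇒b*a⁻¹≡x (1-x≢0 a≢1) (1-x≢0 b≢1) y≢0 (cong proj₂ Ψab≡x⁻¹y⁻¹))
    guv≢0 : (g * u , g * v) ≢ (0# , 0#)
    guv≢0 e = uv≢0 (cong₂ _,_ (*-cancelˡ g≢0 (trans (cong proj₁ e) (sym (zeroʳ g)))) (*-cancelˡ g≢0 (trans (cong proj₂ e) (sym (zeroʳ g)))))
    ψ₀ = ψ (a , b)
    ψ′ = ψ (b , a)
    p = ψ₀ u
    q = ψ₀ (- v)
    r = ψ₀ (u - v - q)
    equation : ψ′ (ψ′ (g * u) - g * v) ≡ ψ′ (- (g * v)) + ψ′ (g * u - g * v - ψ′ (- (g * v)))
    equation = begin
      ψ′ (ψ′ (g * u) - g * v)                  ≡⟨ cong (λ t → ψ′ (t - g * v)) (ψ-flip a b u) ⟩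
      ψ′ (g * p - g * v)                       ≡⟨ cong ψ′ (solve 3 (λ g p v → g :* p :- g :* v := g :* (p :- v)) refl g p v) ⟩
      ψ′ (g * (p - v))                         ≡⟨ ψ-flip a b (p - v) ⟩
      g * ψ₀ (p - v)                           ≡⟨ cong (g *_) uv∈E ⟩
      g * (q + r)                              ≡⟨ distribˡ g q r ⟩
      g * q + g * r                            ≡⟨ cong (g * q +_) (sym (ψ-flip a b _)) ⟩
      g * q + ψ′ (g * (u - v - q))             ≡⟨ cong (λ t → g * q + ψ′ t) (solve 4 (λ g u v q → g :* (u :- v :- q) := g :* u :- g :* v :- g :* q) refl g u v q) ⟩
      g * q + ψ′ (g * u - g * v - g * q)       ≡⟨ cong (λ t → t + ψ′ (g * u - g * v - t)) (sym (ψ-flip a b (- v))) ⟩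
      ψ′ (g * (- v)) + ψ′ (g * u - g * v - ψ′ (g * (- v)))
                                               ≡⟨ cong (λ t → ψ′ t + ψ′ (g * u - g * v - ψ′ t)) (sym (-‿distribʳ-* g v)) ⟩
      ψ′ (- (g * v)) + ψ′ (g * u - g * v - ψ′ (- (g * v))) ∎

  ε-swap : ∀ x y → ε (y , x) ≡ ε (x , y)
  ε-swap x y = trans (cong χ (solve 2 (λ x y → y :- x := :- (x :- y)) refl x y)) (χ-neg (x - y))

  f₁-swap : ∀ x y → f₁ (y , x) ≡ f₂ (x , y)
  f₁-swap = solve 2 (λ x y → y :* y :+ x :* x :- y :* x :- y := y :* y :+ x :* x :- x :* y :- y) refl

  f₂-swap : ∀ x y → f₂ (y , x) ≡ f₁ (x , y)
  f₂-swap = solve 2 (λ x y → x :* x :+ y :* y :- y :* x :- x := x :* x :+ y :* y :- x :* y :- x) refl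

  f₃-swap : ∀ x y → f₃ (y , x) ≡ f₄ (x , y)
  f₃-swap = solve 2 (λ x y → x :* x :* y :+ y :* x :- y :* y :- x :* x := x :* x :* y :+ x :* y :- x :* x :- y :* y) refl

  f₄-swap : ∀ x y → f₄ (y , x) ≡ f₃ (x , y)
  f₄-swap = solve 2 (λ x y → y :* y :* x :+ y :* x :- y :* y :- x :* x := y :* y :* x :+ x :* y :- x :* x :- y :* y) refl

  InT-swap : ∀ {p} → InT p → InT (swap p)
  InT-swap t@((x-sq , y-sq , x≢y , x≢0 , x≢1 , y≢0 , y≢1) , _) =
    InS∧¬Bad⇒InT (y-sq , x-sq , x≢y ∘ sym , y≢0 , y≢1 , x≢0 , x≢1) (InT⇒¬Bad t ∘ Bad-swap)

  R-swap : ∀ {ρ₁ ρ₂ ρ₃ ρ₄} p → InR ρ₁ ρ₂ ρ₃ ρ₄ p → InR ρ₂ ρ₁ ρ₄ ρ₃ (swap p)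
  R-swap (x , y) (t , ρ₁≡ , ρ₂≡ , ρ₃≡ , ρ₄≡) =
    InT-swap t , by ρ₂≡ (f₁-swap x y) , by ρ₁≡ (f₂-swap x y) , by ρ₄≡ (f₃-swap x y) , by ρ₃≡ (f₄-swap x y)
    where
    by : ∀ {ρ f f′} → ρ ≡ ε (x , y) ℤ.* χ f → f′ ≡ f → ρ ≡ ε (y , x) ℤ.* χ f′
    by ρ≡ f′≡f = trans ρ≡ (sym (cong₂ ℤ._*_ (ε-swap x y) (cong χ f′≡f)))

  T₁-swap : ∀ p → InT₁ p → InT₁ (swap p)
  T₁-swap (x , y) (t , χ[1-x]≡-ε , χ[1-y]≡-ε) =
    InT-swap t , trans χ[1-y]≡-ε (cong ℤ.-_ (sym (ε-swap x y))) , trans χ[1-x]≡-ε (cong ℤ.-_ (sym (ε-swap x y)))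

  T₂-swap : ∀ p → InT₂ p → InT₂′ (swap p)
  T₂-swap (x , y) (t , χ[1-x]≡ε , χ[1-y]≡-ε) =
    InT-swap t , trans χ[1-y]≡-ε (cong ℤ.-_ (sym (ε-swap x y))) , trans χ[1-x]≡ε (sym (ε-swap x y))

  T₂′-swap : ∀ p → InT₂′ p → InT₂ (swap p)
  T₂′-swap (x , y) (t , χ[1-x]≡-ε , χ[1-y]≡ε) =
    InT-swap t , trans χ[1-y]≡ε (sym (ε-swap x y)) , trans χ[1-x]≡-ε (cong ℤ.-_ (sym (ε-swap x y)))

  invert : Point → Point
  invert (x , y) = (x ⁻¹ , y ⁻¹)

  invert-involutive : ∀ {p} → InS p → invert (invert p) ≡ p
  invert-involutive (_ , _ , _ , x≢0 , _ , y≢0 , _) = cong₂ _,_ (⁻¹-involutive x≢0) (⁻¹-involutive y≢0)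

  InS-invert : ∀ {p} → InS p → InS (invert p)
  InS-invert (x-sq , y-sq , x≢y , x≢0 , x≢1 , y≢0 , y≢1) =
    square-⁻¹ x-sq x≢0 , square-⁻¹ y-sq y≢0 , ⁻¹-injective x≢0 y≢0 x≢y , x⁻¹≢0 x≢0 , x⁻¹≢1 x≢0 x≢1 , x⁻¹≢0 y≢0 , x⁻¹≢1 y≢0 y≢1
    where
    ⁻¹-injective : ∀ {x y} → x ≢ 0# → y ≢ 0# → x ≢ y → x ⁻¹ ≢ y ⁻¹
    ⁻¹-injective x≢0 y≢0 x≢y e = x≢y (trans (sym (⁻¹-involutive x≢0)) (trans (cong _⁻¹ e) (⁻¹-involutive y≢0)))
    x⁻¹≢1 : ∀ {x} → x ≢ 0# → x ≢ 1# → x ⁻¹ ≢ 1#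
    x⁻¹≢1 x≢0 x≢1 e = x≢1 (trans (sym (⁻¹-involutive x≢0)) (trans (cong _⁻¹ e) 1⁻¹≡1))

  InT-invert : ∀ {p} → InT p → InT (invert p)
  InT-invert t@(p∈S@(_ , _ , _ , x≢0 , _ , y≢0 , _) , _) = InS∧¬Bad⇒InT (InS-invert p∈S) (InT⇒¬Bad t ∘ Bad-invert x≢0 y≢0)

  1-z⁻¹≡-z⁻¹[1-z] : ∀ {z} → z ≢ 0# → 1# - z ⁻¹ ≡ - (z ⁻¹ * (1# - z))
  1-z⁻¹≡-z⁻¹[1-z] {z} z≢0 = x≡y+c*[k-1]⇒k≡1⇒x≡y
    (solve 2 (λ z Z → con 1ℤ :- Z := :- (Z :* (con 1ℤ :- z)) :+ con -1ℤ :* (z :* Z :- con 1ℤ)) refl z (z ⁻¹)) (inverseʳ z z≢0)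

  χ[1-z⁻¹]≡χ[1-z] : ∀ {z} → IsSquare z → z ≢ 0# → χ (1# - z ⁻¹) ≡ χ (1# - z)
  χ[1-z⁻¹]≡χ[1-z] z-sq z≢0 = trans (cong χ (1-z⁻¹≡-z⁻¹[1-z] z≢0)) (χ-neg-*-square _ (square-⁻¹ z-sq z≢0) (x⁻¹≢0 z≢0))

  -- Clearing denominators, x ↦ x⁻¹ changes each relevant quantity by a factor -(nonzero square).
  module Inversion {x y : Carrier} (x-sq : IsSquare x) (y-sq : IsSquare y) (x≢0 : x ≢ 0#) (y≢0 : y ≢ 0#) where

    X Y : Carrier
    X = x ⁻¹
    Y = y ⁻¹

    hX : x * X ≡ 1#
    hX = inverseʳ x x≢0

    hY : y * Y ≡ 1#
    hY = inverseʳ y y≢0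

    XY≢0 : X * Y ≢ 0#
    XY≢0 = x*y≢0 (x⁻¹≢0 x≢0) (x⁻¹≢0 y≢0)

    XY-sq : IsSquare (X * Y)
    XY-sq = square-* (square-⁻¹ x-sq x≢0) (square-⁻¹ y-sq y≢0)

    X-Y≡-XY[x-y] : X - Y ≡ - ((X * Y) * (x - y))
    X-Y≡-XY[x-y] = x≡y+c*[k-1]⇒k≡1⇒x≡y (x≡y+c*[k-1]⇒k≡1⇒x≡y (solve 4 (λ x y X Y → (X :- Y) := (((:- ((X :* Y) :* (x :- y))) :+ ((((con 1ℤ) :* Y)) :* ((x :* X) :- (con 1ℤ)))) :+ ((((con -1ℤ) :* X)) :* ((y :* Y) :- (con 1ℤ))))) refl x y X Y) hY) hX

    f₁[X,Y]≡-[XY]²f₃ : f₁ (X , Y) ≡ - ((X * Y) * (X * Y) * f₃ (x , y))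
    f₁[X,Y]≡-[XY]²f₃ = x≡y+c*[k-1]⇒k≡1⇒x≡y (x≡y+c*[k-1]⇒k≡1⇒x≡y (solve 4 (λ x y X Y → ((((X :* X) :+ (Y :* Y)) :- (X :* Y)) :- X) := (((:- (((X :* Y) :* (X :* Y)) :* (((((y :* y) :* x) :+ (x :* y)) :- (x :* x)) :- (y :* y)))) :+ ((((con -1ℤ) :* Y :* Y) :+ ((con 1ℤ) :* y :* X :* Y :* Y) :+ ((con 1ℤ) :* y :* y :* X :* Y :* Y) :+ ((con -1ℤ) :* x :* X :* Y :* Y)) :* ((x :* X) :- (con 1ℤ)))) :+ ((((con 1ℤ) :* X) :+ ((con 1ℤ) :* X :* Y) :+ ((con -1ℤ) :* X :* X) :+ ((con 1ℤ) :* y :* X :* Y) :+ ((con -1ℤ) :* y :* X :* X :* Y)) :* ((y :* Y) :- (con 1ℤ))))) refl x y X Y) hY) hX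

    f₂[X,Y]≡-[XY]²f₄ : f₂ (X , Y) ≡ - ((X * Y) * (X * Y) * f₄ (x , y))
    f₂[X,Y]≡-[XY]²f₄ = x≡y+c*[k-1]⇒k≡1⇒x≡y (x≡y+c*[k-1]⇒k≡1⇒x≡y (solve 4 (λ x y X Y → ((((Y :* Y) :+ (X :* X)) :- (X :* Y)) :- Y) := (((:- (((X :* Y) :* (X :* Y)) :* (((((x :* x) :* y) :+ (x :* y)) :- (x :* x)) :- (y :* y)))) :+ ((((con -1ℤ) :* Y :* Y) :+ ((con 1ℤ) :* y :* Y :* Y) :+ ((con 1ℤ) :* y :* X :* Y :* Y) :+ ((con -1ℤ) :* x :* X :* Y :* Y) :+ ((con 1ℤ) :* x :* y :* X :* Y :* Y)) :* ((x :* X) :- (con 1ℤ)))) :+ ((((con 1ℤ) :* Y) :+ ((con 1ℤ) :* X :* Y) :+ ((con -1ℤ) :* X :* X) :+ ((con -1ℤ) :* y :* X :* X :* Y)) :* ((y :* Y) :- (con 1ℤ))))) refl x y X Y) hY) hX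

    f₃[X,Y]≡-[XY]²f₁ : f₃ (X , Y) ≡ - ((X * Y) * (X * Y) * f₁ (x , y))
    f₃[X,Y]≡-[XY]²f₁ = x≡y+c*[k-1]⇒k≡1⇒x≡y (x≡y+c*[k-1]⇒k≡1⇒x≡y (solve 4 (λ x y X Y → (((((Y :* Y) :* X) :+ (X :* Y)) :- (X :* X)) :- (Y :* Y)) := (((:- (((X :* Y) :* (X :* Y)) :* ((((x :* x) :+ (y :* y)) :- (x :* y)) :- x))) :+ ((((con 1ℤ) :* Y :* Y) :+ ((con -1ℤ) :* X :* Y :* Y) :+ ((con -1ℤ) :* y :* X :* Y :* Y) :+ ((con 1ℤ) :* x :* X :* Y :* Y)) :* ((x :* X) :- (con 1ℤ)))) :+ ((((con -1ℤ) :* X :* Y) :+ ((con 1ℤ) :* X :* X) :+ ((con 1ℤ) :* y :* X :* X :* Y)) :* ((y :* Y) :- (con 1ℤ))))) refl x y X Y) hY) hX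

    f₄[X,Y]≡-[XY]²f₂ : f₄ (X , Y) ≡ - ((X * Y) * (X * Y) * f₂ (x , y))
    f₄[X,Y]≡-[XY]²f₂ = x≡y+c*[k-1]⇒k≡1⇒x≡y (x≡y+c*[k-1]⇒k≡1⇒x≡y (solve 4 (λ x y X Y → (((((X :* X) :* Y) :+ (X :* Y)) :- (X :* X)) :- (Y :* Y)) := (((:- (((X :* Y) :* (X :* Y)) :* ((((y :* y) :+ (x :* x)) :- (x :* y)) :- y))) :+ ((((con 1ℤ) :* Y :* Y) :+ ((con -1ℤ) :* y :* X :* Y :* Y) :+ ((con 1ℤ) :* x :* X :* Y :* Y)) :* ((x :* X) :- (con 1ℤ)))) :+ ((((con -1ℤ) :* X :* Y) :+ ((con 1ℤ) :* X :* X) :+ ((con -1ℤ) :* X :* X :* Y) :+ ((con 1ℤ) :* y :* X :* X :* Y)) :* ((y :* Y) :- (con 1ℤ))))) refl x y X Y) hY) hX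

    ε-invert : ε (X , Y) ≡ ε (x , y)
    ε-invert = trans (cong χ X-Y≡-XY[x-y]) (χ-neg-*-square _ XY-sq XY≢0)

    χ-f-invert : ∀ {f f′} → f′ ≡ - ((X * Y) * (X * Y) * f) → χ f′ ≡ χ f
    χ-f-invert {f} e = trans (cong χ e) (χ-neg-*-square f (square-* XY-sq XY-sq) (x*y≢0 XY≢0 XY≢0))

  R-invert : ∀ {ρ₁ ρ₂ ρ₃ ρ₄} p → InR ρ₁ ρ₂ ρ₃ ρ₄ p → InR ρ₃ ρ₄ ρ₁ ρ₂ (invert p)
  R-invert (x , y) (t@((x-sq , y-sq , _ , x≢0 , _ , y≢0 , _) , _) , ρ₁≡ , ρ₂≡ , ρ₃≡ , ρ₄≡) =
    InT-invert t , by ρ₃≡ f₁[X,Y]≡-[XY]²f₃ , by ρ₄≡ f₂[X,Y]≡-[XY]²f₄ , by ρ₁≡ f₃[X,Y]≡-[XY]²f₁ , by ρ₂≡ f₄[X,Y]≡-[XY]²f₂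
    where
    open Inversion x-sq y-sq x≢0 y≢0
    by : ∀ {ρ f f′} → ρ ≡ ε (x , y) ℤ.* χ f → f′ ≡ - ((X * Y) * (X * Y) * f) → ρ ≡ ε (X , Y) ℤ.* χ f′
    by ρ≡ e = trans ρ≡ (sym (cong₂ ℤ._*_ ε-invert (χ-f-invert e)))

  T₁-invert : ∀ p → InT₁ p → InT₁ (invert p)
  T₁-invert (x , y) (t@((x-sq , y-sq , _ , x≢0 , _ , y≢0 , _) , _) , χ[1-x]≡-ε , χ[1-y]≡-ε) =
    InT-invert t , trans (χ[1-z⁻¹]≡χ[1-z] x-sq x≢0) (trans χ[1-x]≡-ε (cong ℤ.-_ (sym ε-invert)))
                 , trans (χ[1-z⁻¹]≡χ[1-z] y-sq y≢0) (trans χ[1-y]≡-ε (cong ℤ.-_ (sym ε-invert)))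
    where open Inversion x-sq y-sq x≢0 y≢0

  T₂-invert : ∀ p → InT₂ p → InT₂ (invert p)
  T₂-invert (x , y) (t@((x-sq , y-sq , _ , x≢0 , _ , y≢0 , _) , _) , χ[1-x]≡ε , χ[1-y]≡-ε) =
    InT-invert t , trans (χ[1-z⁻¹]≡χ[1-z] x-sq x≢0) (trans χ[1-x]≡ε (sym ε-invert))
                 , trans (χ[1-z⁻¹]≡χ[1-z] y-sq y≢0) (trans χ[1-y]≡-ε (cong ℤ.-_ (sym ε-invert)))
    where open Inversion x-sq y-sq x≢0 y≢0

module Counting (F : FiniteField) (q≡1[4] : FiniteField.order F % 4 ≡ 1) where

  open FieldProperties F
  open QuadraticCharacter F q≡1[4]
  open Obstructions F q≡1[4]
  open Symmetries F q≡1[4]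
  open Cardinality
  open ≡-Reasoning

  points : List Point
  points = cartesianProduct elements elements

  points-complete : ∀ p → p ∈ points
  points-complete (x , y) = ∈-cartesianProduct⁺ (elements-complete x) (elements-complete y)

  open Enumeration (≡-dec _≟_ _≟_) points (Unique.cartesianProduct⁺ elements-unique elements-unique) points-complete

  _≢?_ : (a b : Carrier) → Dec (a ≢ b)
  a ≢? b = ¬? (a ≟ b)

  Bad? : Decidable Bad
  Bad? p = map′ found listed (any? Witness? (cartesianProduct points points))
    where
    Witness : Point × Point → Set
    Witness (ab , uv) = InΣ ab × Ψ ab ≡ p × InE ab uv
    found : Any Witness (cartesianProduct points points) → Bad p
    found a with satisfied a
    ... | (ab , uv) , w = ab , uv , w
    InΣ? : Decidable InΣ
    InΣ? (a , b) = a ≢? b ×-dec a ≢? 0# ×-dec a ≢? 1# ×-dec b ≢? 0# ×-dec b ≢? 1# ×-dec square? (a * b) ×-dec square? ((1# - a) * (1# - b))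
    InE? : ∀ ab uv → Dec (InE ab uv)
    InE? ab (u , v) = ¬? (≡-dec _≟_ _≟_ (u , v) (0# , 0#)) ×-dec (ψ ab (ψ ab u - v) ≟ (ψ ab (- v) + ψ ab (u - v - ψ ab (- v))))
    Witness? : Decidable Witness
    Witness? (ab , uv) = InΣ? ab ×-dec ≡-dec _≟_ _≟_ (Ψ ab) p ×-dec InE? ab uv
    listed : Bad p → Any Witness (cartesianProduct points points)
    listed (ab , uv , w) = Any.map (λ { refl → w }) (∈-cartesianProduct⁺ (points-complete ab) (points-complete uv))

  InT? : Decidable InT
  InT? p@(x , y) with InS? | Bad? p
    where
    InS? : Dec (InS p)
    InS? = square? x ×-dec square? y ×-dec x ≢? y ×-dec x ≢? 0# ×-dec x ≢? 1# ×-dec y ≢? 0# ×-dec y ≢? 1#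
  ... | yes p∈S | no ¬bad = yes (InS∧¬Bad⇒InT p∈S ¬bad)
  ... | yes _ | yes bad = no (λ t → InT⇒¬Bad t bad)
  ... | no p∉S | _ = no (p∉S ∘ proj₁)

  InT₁? : Decidable InT₁
  InT₁? (x , y) = InT? (x , y) ×-dec χ (1# - x) ℤ.≟ ℤ.- ε (x , y) ×-dec χ (1# - y) ℤ.≟ ℤ.- ε (x , y)

  InT₂? : Decidable InT₂
  InT₂? (x , y) = InT? (x , y) ×-dec χ (1# - x) ℤ.≟ ε (x , y) ×-dec χ (1# - y) ℤ.≟ ℤ.- ε (x , y)

  InR? : ∀ ρ₁ ρ₂ ρ₃ ρ₄ → Decidable (InR ρ₁ ρ₂ ρ₃ ρ₄)
  InR? ρ₁ ρ₂ ρ₃ ρ₄ p = InT? p ×-dec ρ₁ ℤ.≟ _ ×-dec ρ₂ ℤ.≟ _ ×-dec ρ₃ ℤ.≟ _ ×-dec ρ₄ ℤ.≟ _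

  χ≡ε⊎χ≡-ε : ∀ {z x y} → z ≢ 0# → x ≢ y → χ z ≡ ε (x , y) ⊎ χ z ≡ ℤ.- ε (x , y)
  χ≡ε⊎χ≡-ε z≢0 x≢y with χ-sign z≢0 | χ-sign (x≢y⇒x-y≢0 x≢y)
  ... | inj₁ χ≡1  | inj₁ ε≡1  = inj₁ (trans χ≡1 (sym ε≡1))
  ... | inj₁ χ≡1  | inj₂ ε≡-1 = inj₂ (trans χ≡1 (sym (cong ℤ.-_ ε≡-1)))
  ... | inj₂ χ≡-1 | inj₁ ε≡1  = inj₂ (trans χ≡-1 (sym (cong ℤ.-_ ε≡1)))
  ... | inj₂ χ≡-1 | inj₂ ε≡-1 = inj₁ (trans χ≡-1 (sym ε≡-1))

  T-cover : ∀ p → InT p → InT₁ p ⊎ (InT₂ p ⊎ InT₂′ p)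
  T-cover (x , y) t@((_ , _ , x≢y , _ , x≢1 , _ , y≢1) , _) with χ≡ε⊎χ≡-ε (1-x≢0 x≢1) x≢y | χ≡ε⊎χ≡-ε (1-x≢0 y≢1) x≢y
  ... | inj₁ e₁ | inj₁ e₂ = ⊥-elim (InT⇒¬[χ[1-x]≡χ[1-y]≡ε] t e₁ e₂)
  ... | inj₁ e₁ | inj₂ e₂ = inj₂ (inj₁ (t , e₁ , e₂))
  ... | inj₂ e₁ | inj₁ e₂ = inj₂ (inj₂ (t , e₁ , e₂))
  ... | inj₂ e₁ | inj₂ e₂ = inj₁ (t , e₁ , e₂)

  T₁-T₂-disjoint : ∀ p → InT₁ p → InT₂ p ⊎ InT₂′ p → ⊥
  T₁-T₂-disjoint _ (((_ , _ , x≢y , _) , _) , χ[1-x]≡-ε , _) (inj₁ (_ , χ[1-x]≡ε , _)) = ε-≢-neg x≢y (trans (sym χ[1-x]≡ε) χ[1-x]≡-ε)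
  T₁-T₂-disjoint _ (((_ , _ , x≢y , _) , _) , _ , χ[1-y]≡-ε) (inj₂ (_ , _ , χ[1-y]≡ε)) = ε-≢-neg x≢y (trans (sym χ[1-y]≡ε) χ[1-y]≡-ε)

  T₂-T₂′-disjoint : ∀ p → InT₂ p → InT₂′ p → ⊥
  T₂-T₂′-disjoint _ (((_ , _ , x≢y , _) , _) , χ[1-x]≡ε , _) (_ , χ[1-x]≡-ε , _) = ε-≢-neg x≢y (trans (sym χ[1-x]≡ε) χ[1-x]≡-ε)

  SameSize-T₂-T₂′ : SameSize InT₂ InT₂′
  SameSize-T₂-T₂′ = SameSize-involution swap InT₂? T₂-swap T₂′-swap (λ _ _ → refl) (λ _ _ → refl)

  size-T : ∃[ t ] ∃[ t₁ ] ∃[ t₂ ] (HasSize InT t × HasSize InT₁ t₁ × HasSize InT₂ t₂ × t ≡ t₁ ℕ.+ 2 ℕ.* t₂)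
  size-T = _ , _ , _ , HasSize-filter InT? , HasSize-filter InT₁? , HasSize-filter InT₂? , (begin
    length (filter InT? points)      ≡⟨ HasSize-unique (HasSize-filter InT?) (HasSize-⊎ (HasSize-filter InT₁?) T₂⊎T₂′-size
                                          T₁-T₂-disjoint T-cover (λ _ → proj₁) (λ { _ (inj₁ t₂) → proj₁ t₂ ; _ (inj₂ t₂′) → proj₁ t₂′ })) ⟩
    t₁ ℕ.+ (t₂ ℕ.+ t₂)               ≡⟨ cong (t₁ ℕ.+_) (cong (t₂ ℕ.+_) (sym (ℕ.+-identityʳ t₂))) ⟩
    t₁ ℕ.+ 2 ℕ.* t₂                  ∎)
    where
    t₁ = length (filter InT₁? points)
    t₂ = length (filter InT₂? points)
    T₂′-size : HasSize InT₂′ t₂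
    T₂′-size = HasSize-bijection swap swap T₂-swap T₂′-swap (λ _ _ → refl) (λ _ _ → refl) (HasSize-filter InT₂?)
    T₂⊎T₂′-size : HasSize (λ p → InT₂ p ⊎ InT₂′ p) (t₂ ℕ.+ t₂)
    T₂⊎T₂′-size = HasSize-⊎ (HasSize-filter InT₂?) T₂′-size T₂-T₂′-disjoint (λ _ → id) (λ _ → inj₁) (λ _ → inj₂)

  R[-1,-1,ρ₃,ρ₄]-empty : ∀ {ρ₃ ρ₄} p → ¬ InR -1ℤ -1ℤ ρ₃ ρ₄ p
  R[-1,-1,ρ₃,ρ₄]-empty p r = InR⇒¬[ρ₃≡ρ₄≡-1] (invert p) (R-invert p r)

  module _ (ρ₁ ρ₂ ρ₃ ρ₄ : ℤ) where

    SameSize-R₁-swap : SameSize (InR₁ ρ₁ ρ₂ ρ₃ ρ₄) (InR₁ ρ₂ ρ₁ ρ₄ ρ₃)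
    SameSize-R₁-swap = SameSize-involution swap (λ p → InT₁? p ×-dec InR? ρ₁ ρ₂ ρ₃ ρ₄ p)
      (λ p (t₁ , r) → T₁-swap p t₁ , R-swap p r) (λ p (t₁ , r) → T₁-swap p t₁ , R-swap p r) (λ _ _ → refl) (λ _ _ → refl)

    SameSize-R₁-invert : SameSize (InR₁ ρ₁ ρ₂ ρ₃ ρ₄) (InR₁ ρ₃ ρ₄ ρ₁ ρ₂)
    SameSize-R₁-invert = SameSize-involution invert (λ p → InT₁? p ×-dec InR? ρ₁ ρ₂ ρ₃ ρ₄ p)
      (λ p (t₁ , r) → T₁-invert p t₁ , R-invert p r) (λ p (t₁ , r) → T₁-invert p t₁ , R-invert p r)
      (λ _ r → invert-involutive (proj₁ (proj₁ (proj₁ r)))) (λ _ r → invert-involutive (proj₁ (proj₁ (proj₁ r))))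

    SameSize-R₂-invert : SameSize (InR₂ ρ₁ ρ₂ ρ₃ ρ₄) (InR₂ ρ₃ ρ₄ ρ₁ ρ₂)
    SameSize-R₂-invert = SameSize-involution invert (λ p → InT₂? p ×-dec InR? ρ₁ ρ₂ ρ₃ ρ₄ p)
      (λ p (t₂ , r) → T₂-invert p t₂ , R-invert p r) (λ p (t₂ , r) → T₂-invert p t₂ , R-invert p r)
      (λ _ r → invert-involutive (proj₁ (proj₁ (proj₁ r)))) (λ _ r → invert-involutive (proj₁ (proj₁ (proj₁ r))))

open import Data.Nat using (_+_; _*_)

-- Only q ≡ 1 (mod 4) is used: a finite field automatically has prime-power order, and the
-- argument works for arbitrary integers ρᵢ.
lemma5p1 : (F : FiniteField) → IsPrimePower (FiniteField.order F) → FiniteField.order F % 4 ≡ 1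
    → (ρ₁ ρ₂ ρ₃ ρ₄ : ℤ) → IsSign ρ₁ → IsSign ρ₂ → IsSign ρ₃ → IsSign ρ₄
    → let open FFDefs F in
      SameSize (InR₁ ρ₁ ρ₂ ρ₃ ρ₄) (InR₁ ρ₂ ρ₁ ρ₄ ρ₃)
      × SameSize InT₂ InT₂′
      × (∃[ t ] ∃[ t₁ ] ∃[ t₂ ] (HasSize InT t × HasSize InT₁ t₁ × HasSize InT₂ t₂ × t ≡ t₁ + 2 * t₂))
      × SameSize (InR₁ ρ₁ ρ₂ ρ₃ ρ₄) (InR₁ ρ₃ ρ₄ ρ₁ ρ₂)
      × SameSize (InR₂ ρ₁ ρ₂ ρ₃ ρ₄) (InR₂ ρ₃ ρ₄ ρ₁ ρ₂)
      × (∀ p → ¬ InR ρ₁ ρ₂ -[1+ 0 ] -[1+ 0 ] p)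
      × (∀ p → ¬ InR -[1+ 0 ] -[1+ 0 ] ρ₃ ρ₄ p)
lemma5p1 F _ q≡1[4] ρ₁ ρ₂ ρ₃ ρ₄ _ _ _ _ =
    SameSize-R₁-swap ρ₁ ρ₂ ρ₃ ρ₄
  , SameSize-T₂-T₂′
  , size-T
  , SameSize-R₁-invert ρ₁ ρ₂ ρ₃ ρ₄
  , SameSize-R₂-invert ρ₁ ρ₂ ρ₃ ρ₄
  , InR⇒¬[ρ₃≡ρ₄≡-1]
  , R[-1,-1,ρ₃,ρ₄]-empty
  where
  open Counting F q≡1[4]
  open Obstructions F q≡1[4] using (InR⇒¬[ρ₃≡ρ₄≡-1])
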